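{- If a CNF formula $F$ has a resolution refutation of width $w$ and length $L$, then it has a Sherali-Adams (SA) refutation of rank $w+1$ and size $O(w2^wL)$ and a Sherali-Adams resolution (SAR) refutation of rank $w+1$ and size $O(w^2L)$.
   Context: Resolution: a refutation of a CNF $F$ is a sequence of clauses $(C_1,\dots,C_L)$ ending with the empty clause, each being a clause of $F$, or $A\lor B$ obtained from earlier $A\lor x$ and $B\lor\bar x$, or a superset of an earlier clause (weakening); its length is $L$ and its width the maximum number of literals in a clause. SA: over variables $x_1,\dots,x_n$, a clause $\bigvee_{i\in I}x_i\lor\bigvee_{j\in J}\bar x_j$ is encoded as $\sum_{i\in I}x_i+\sum_{j\in J}(1-x_j)-1\ge0$. An SA derivation of $r\ge0$ from $q_1\ge0,\dots,q_m\ge0$ is an expression $\sum_{t=1}^{\tau}\alpha_t\prod_{i\in I_t}x_i\prod_{j\in J_t}(1-x_j)\,p_t$ with reals $\alpha_t\ge0$ and each $p_t$ one of the $q_j$, an axiom $x_i^2-x_i$ or $x_i-x_i^2$, or the constant $1$, which expands to $r$. A refutation of $F$ is a derivation of $-1\ge0$ from the encodings of its clauses. Rank is the maximum degree of the polynomials to which the summands expand; size is the sum of their numbers of terms. SAR: the same, except that the variables are $x_1,\dots,x_n,\bar x_1,\dots,\bar x_n$ (twins treated as independent variables, products and axioms $x^2-x$, $x-x^2$ allowed for all of them), a clause $\bigvee_{i\in I}x_i\lor\bigvee_{j\in J}\bar x_j$ is encoded as $\sum_{i\in I}x_i+\sum_{j\in J}\bar x_j-1\ge0$, and $p_t$ may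 additionally be a complementarity axiom $1-x_i-\bar x_i$ or $-1+x_i+\bar x_i$. -}

module Defs where

open import Data.Nat as ℕ using (ℕ; zero; suc; _⊔_; _<_)
open import Data.Fin using (Fin; toℕ; _↑ˡ_; _↑ʳ_)
open import Data.Fin.Subset using (Subset; inside; outside; _∪_; ⁅_⁆; ⊥; _⊆_)
open import Data.Bool using (Bool; true; false; if_then_else_)
open import Data.Vec as V using (Vec; replicate; _[_]≔_; zipWith; lookup)
open import Data.Vec.Properties using (≡-dec)
open import Data.List as L using (List; []; _∷_; _++_; map; concatMap; foldr; length; allFin; filter; deduplicate)
open import Data.List.Membership.Propositional using (_∈_)
open import Data.Product using (Σ; _×_; _,_; proj₁; proj₂)
open import Data.Rational as Q using (ℚ; 0ℚ; 1ℚ)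
open import Relation.Nullary using (¬?)
open import Relation.Binary.PropositionalEquality using (_≡_)

-- CNF formulas over variables x_0 .. x_{n-1}
-- A clause  ⋁_{i∈P} x_i ∨ ⋁_{j∈N} x̄_j  is the pair of subsets (P , N).

Clause : ℕ → Set
Clause n = Subset n × Subset n

CNF : ℕ → Set
CNF n = List (Clause n)

data Literal (n : ℕ) : Set where
  pos : Fin n → Literal n
  neg : Fin n → Literal n

compl : ∀ {n} → Literal n → Literal n
compl (pos i) = neg i
compl (neg i) = pos i

_∨ₗ_ : ∀ {n} → Clause n → Literal n → Clause n
(P , N) ∨ₗ pos i = (P ∪ ⁅ i ⁆ , N)
(P , N) ∨ₗ neg i = (P , N ∪ ⁅ i ⁆)

_∨c_ : ∀ {n} → Clause n → Clause n → Clause n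
(P , N) ∨c (P' , N') = (P ∪ P' , N ∪ N')

emptyClause : ∀ {n} → Clause n
emptyClause = (⊥ , ⊥)

_⊆c_ : ∀ {n} → Clause n → Clause n → Set
(P , N) ⊆c (P' , N') = (P ⊆ P') × (N ⊆ N')

width : ∀ {n} → Clause n → ℕ
width (P , N) = Data.Fin.Subset.∣ P ∣ ℕ.+ Data.Fin.Subset.∣ N ∣

data Step {n : ℕ} (F : CNF n) {L : ℕ} (C : Fin L → Clause n) (k : Fin L) : Set where
  axiom : C k ∈ F → Step F C k
  resolve : (i j : Fin L) → toℕ i < toℕ k → toℕ j < toℕ k →
            (A B : Clause n) (x : Literal n) →
            C i ≡ A ∨ₗ x → C j ≡ B ∨ₗ compl x → C k ≡ A ∨c B → Step F C k
  weaken : (i : Fin L) → toℕ i < toℕ k → C i ⊆c C k → Step F C k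

record ResRefutation {n : ℕ} (F : CNF n) (w L : ℕ) : Set where
  field
    clauses : Fin L → Clause n
    steps   : ∀ k → Step F clauses k
    endsEmpty : Σ (Fin L) λ k → (suc (toℕ k) ≡ L) × (clauses k ≡ emptyClause)
    narrow  : ∀ k → width (clauses k) ℕ.≤ w

-- Polynomials with rational coefficients in m variables, as formal sums
-- of terms (coefficient, exponent vector).  Equality is equality of
-- coefficients of every monomial after collecting terms.

Mono : ℕ → Set
Mono m = Vec ℕ m

Poly : ℕ → Set
Poly m = List (ℚ × Mono m)

constP : ∀ {m} → ℚ → Poly m
constP c = (c , replicate _ 0) ∷ []

varP : ∀ {m} → Fin m → Poly m
varP i = (1ℚ , (replicate _ 0 [ i ]≔ 1)) ∷ []

_+P_ : ∀ {m} → Poly m → Poly m → Poly m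
p +P q = p ++ q

_*P_ : ∀ {m} → Poly m → Poly m → Poly m
p *P q = concatMap (λ t → map (λ s → (proj₁ t Q.* proj₁ s , zipWith ℕ._+_ (proj₂ t) (proj₂ s))) q) p

-P_ : ∀ {m} → Poly m → Poly m
-P p = map (λ t → (Q.- proj₁ t , proj₂ t)) p

_-P_ : ∀ {m} → Poly m → Poly m → Poly m
p -P q = p +P (-P q)

coeff : ∀ {m} → Poly m → Mono m → ℚ
coeff [] u = 0ℚ
coeff ((a , v) ∷ p) u with ≡-dec ℕ._≟_ v u
... | Relation.Nullary.yes _ = a Q.+ coeff p u
... | Relation.Nullary.no  _ = coeff p u

_≈P_ : ∀ {m} → Poly m → Poly m → Set
p ≈P q = ∀ u → coeff p u ≡ coeff q u

support : ∀ {m} → Poly m → List (Mono m)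
support p = filter (λ u → ¬? (coeff p u Q.≟ 0ℚ)) (deduplicate (≡-dec ℕ._≟_) (map proj₂ p))

nTerms : ∀ {m} → Poly m → ℕ
nTerms p = length (support p)

-- total degree (0 for the zero polynomial)
degree : ∀ {m} → Poly m → ℕ
degree p = foldr (λ u d → V.foldr (λ _ → ℕ) ℕ._+_ 0 u ⊔ d) 0 (support p)

sumOver : ∀ {m} → (Fin m → Poly m) → Subset m → Poly m
sumOver {m} f I = foldr (λ i acc → if lookup I i then f i +P acc else acc) [] (allFin m)

prodOver : ∀ {m} → (Fin m → Poly m) → Subset m → Poly m
prodOver {m} f I = foldr (λ i acc → if lookup I i then f i *P acc else acc) (constP 1ℚ) (allFin m)

-- Sherali–Adams style derivations from a list of allowed polynomials Ax
-- (hypotheses, Boolean axioms, constant 1, ...)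

record Summand {m : ℕ} (Ax : List (Poly m)) : Set where
  field
    α   : ℚ
    α≥0 : 0ℚ Q.≤ α
    I J : Subset m
    p   : Poly m
    p∈  : p ∈ Ax

expand : ∀ {m} {Ax : List (Poly m)} → Summand Ax → Poly m
expand s = constP α *P (prodOver varP I *P (prodOver (λ j → constP 1ℚ -P varP j) J *P p))
  where open Summand s

Derivation : ∀ {m} → List (Poly m) → Set
Derivation Ax = List (Summand Ax)

total : ∀ {m} {Ax : List (Poly m)} → Derivation Ax → Poly m
total d = foldr (λ s acc → expand s +P acc) [] d

-- refutation: derivation of -1 ≥ 0
Refutes : ∀ {m} {Ax : List (Poly m)} → Derivation Ax → Set
Refutes d = total d ≈P constP (Q.- 1ℚ)

rank : ∀ {m} {Ax : List (Poly m)} → Derivation Ax → ℕ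
rank d = foldr (λ s r → degree (expand s) ⊔ r) 0 d

size : ∀ {m} {Ax : List (Poly m)} → Derivation Ax → ℕ
size d = foldr (λ s r → nTerms (expand s) ℕ.+ r) 0 d

boolAxioms : ∀ {m} → List (Poly m)
boolAxioms {m} = concatMap (λ i → ((varP i *P varP i) -P varP i) ∷ (varP i -P (varP i *P varP i)) ∷ []) (allFin m)

encSA : ∀ {n} → Clause n → Poly n
encSA (P , N) = (sumOver varP P +P sumOver (λ j → constP 1ℚ -P varP j) N) -P constP 1ℚ

axiomsSA : ∀ {n} → CNF n → List (Poly n)
axiomsSA F = map encSA F ++ (boolAxioms ++ (constP 1ℚ ∷ []))

SARefutation : ∀ {n} → CNF n → Set
SARefutation F = Derivation (axiomsSA F)

-- SAR: variables x_0..x_{n-1}, x̄_0..x̄_{n-1}; x_i is variable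
-- i ↑ˡ n and x̄_i is variable n ↑ʳ i of Fin (n + n).

xV : ∀ {n} → Fin n → Fin (n ℕ.+ n)
xV {n} i = i ↑ˡ n

x̄V : ∀ {n} → Fin n → Fin (n ℕ.+ n)
x̄V {n} i = n ↑ʳ i

sumPos : ∀ {n} → Subset n → Poly (n ℕ.+ n)
sumPos {n} P = foldr (λ i acc → if lookup P i then varP (xV i) +P acc else acc) [] (allFin n)

sumNeg : ∀ {n} → Subset n → Poly (n ℕ.+ n)
sumNeg {n} N = foldr (λ i acc → if lookup N i then varP (x̄V i) +P acc else acc) [] (allFin n)

encSAR : ∀ {n} → Clause n → Poly (n ℕ.+ n)
encSAR (P , N) = (sumPos P +P sumNeg N) -P constP 1ℚ

complAxioms : ∀ {n} → List (Poly (n ℕ.+ n))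
complAxioms {n} = concatMap (λ i →
    ((constP 1ℚ -P varP (xV i)) -P varP (x̄V i))
  ∷ ((constP (Q.- 1ℚ) +P varP (xV i)) +P varP (x̄V i)) ∷ []) (allFin n)

axiomsSAR : ∀ {n} → CNF n → List (Poly (n ℕ.+ n))
axiomsSAR {n} F = map encSAR F ++ (boolAxioms ++ (complAxioms {n} ++ (constP 1ℚ ∷ [])))

SARRefutation : ∀ {n} → CNF n → Set
SARRefutation F = Derivation (axiomsSAR F)

module Submission where

-- Let φ(ℓ) be the polynomial "ℓ is false" (1 - x_i for ℓ = x_i and x_i
-- for ℓ = x̄_i in SA; x̄_i resp. x_i in SAR) and D(C) = ∏_{ℓ∈C} φ(ℓ) the
-- indicator that the clause C is falsified; D(□) = 1.  Walking backwards through
-- the resolution refutation C_1, …, C_L = □ we maintain a derivation d and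
-- nonnegative weights c_k on the clauses not yet processed with
--          total d - Σ_k c_k D(C_k) = -1.
-- Initially d is empty and only C_L has weight 1.  Processing C_k with weight c
-- adds a derivation of c·(-D(C_k)) for an axiom, c·(D(A∨x) + D(B∨x̄) - D(A∨B))
-- for a resolvent and c·(D(U) - D(V)) for a weakening of U, moving the weight c
-- to the premises.  Each of these pieces has rank ≤ w+1 and uses O(w) summands
-- whose products D(W) have at most 2^|W| (SA) resp. 1 (SAR) terms.

open import Defs
open import Data.Nat using (ℕ; suc; _*_; _^_; _≤_; _⊔_)
open import Data.Product using (Σ; _×_)
open import Data.List using (List)

module Polynomials where

  open import Data.Nat as ℕ using (ℕ; suc)
  import Data.Nat.Properties as NP
  open import Data.Vec as V using (replicate; zipWith)
  open import Data.Vec.Properties as VP using (≡-dec)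
  open import Data.List using (List; []; _∷_; _++_; map; concatMap; length; filter)
  import Data.List.Properties as LP
  open import Data.Product using (_×_; _,_; proj₁; proj₂)
  open import Data.Rational as Q using (ℚ; 0ℚ; 1ℚ)
  import Data.Rational.Properties as QP
  open import Data.Rational.Solver using (module +-*-Solver)
  open +-*-Solver using (solve; _:+_; _:*_; :-_; _:=_)
  open import Data.Empty using (⊥-elim)
  open import Relation.Nullary using (Dec; yes; no; ¬_; ¬?)
  open import Relation.Binary.PropositionalEquality
  open import Relation.Binary.Structures using (IsEquivalence)
  open import Algebra.Bundles using (CommutativeRing)

  Term : ℕ → Set
  Term m = ℚ × Mono m

  δ : ∀ {m} → Mono m → Mono m → ℚ
  δ v u with ≡-dec ℕ._≟_ v u
  ... | yes _ = 1ℚ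
  ... | no _ = 0ℚ

  Σl : ∀ {A : Set} → (A → ℚ) → List A → ℚ
  Σl f [] = 0ℚ
  Σl f (x ∷ xs) = f x Q.+ Σl f xs

  coeff-cons : ∀ {m} a (v : Mono m) p u → coeff ((a , v) ∷ p) u ≡ a Q.* δ v u Q.+ coeff p u
  coeff-cons a v p u with ≡-dec ℕ._≟_ v u
  ... | yes _ = cong (Q._+ coeff p u) (sym (QP.*-identityʳ a))
  ... | no _ = trans (sym (QP.+-identityˡ (coeff p u))) (cong (Q._+ coeff p u) (sym (QP.*-zeroʳ a)))

  LF : ∀ {m} → Poly m → (Mono m → ℚ) → ℚ
  LF p G = Σl (λ t → proj₁ t Q.* G (proj₂ t)) p

  coeff-LF : ∀ {m} (p : Poly m) u → coeff p u ≡ LF p (λ v → δ v u)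
  coeff-LF [] u = refl
  coeff-LF ((a , v) ∷ p) u = trans (coeff-cons a v p u) (cong (a Q.* δ v u Q.+_) (coeff-LF p u))

  Σl-++ : ∀ {A : Set} (f : A → ℚ) xs ys → Σl f (xs ++ ys) ≡ Σl f xs Q.+ Σl f ys
  Σl-++ f [] ys = sym (QP.+-identityˡ _)
  Σl-++ f (x ∷ xs) ys = trans (cong (f x Q.+_) (Σl-++ f xs ys)) (sym (QP.+-assoc (f x) _ _))

  Σl-map : ∀ {A B : Set} (f : B → ℚ) (g : A → B) xs → Σl f (map g xs) ≡ Σl (λ x → f (g x)) xs
  Σl-map f g [] = refl
  Σl-map f g (x ∷ xs) = cong (f (g x) Q.+_) (Σl-map f g xs)

  Σl-concatMap : ∀ {A B : Set} (f : B → ℚ) (g : A → List B) xs → Σl f (concatMap g xs) ≡ Σl (λ x → Σl f (g x)) xs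
  Σl-concatMap f g [] = refl
  Σl-concatMap f g (x ∷ xs) = trans (Σl-++ f (g x) (concatMap g xs)) (cong (Σl f (g x) Q.+_) (Σl-concatMap f g xs))

  Σl-cong : ∀ {A : Set} {f g : A → ℚ} → (∀ x → f x ≡ g x) → ∀ xs → Σl f xs ≡ Σl g xs
  Σl-cong h [] = refl
  Σl-cong h (x ∷ xs) = cong₂ Q._+_ (h x) (Σl-cong h xs)

  Σl-+ : ∀ {A : Set} (f g : A → ℚ) xs → Σl (λ x → f x Q.+ g x) xs ≡ Σl f xs Q.+ Σl g xs
  Σl-+ f g [] = refl
  Σl-+ f g (x ∷ xs) = trans (cong ((f x Q.+ g x) Q.+_) (Σl-+ f g xs)) (lem (f x) (g x) (Σl f xs) (Σl g xs))
    where
    lem : ∀ a b c d → (a Q.+ b) Q.+ (c Q.+ d) ≡ (a Q.+ c) Q.+ (b Q.+ d)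
    lem = solve 4 (λ a b c d → (a :+ b) :+ (c :+ d) := (a :+ c) :+ (b :+ d)) refl

  Σl-* : ∀ {A : Set} (c : ℚ) (f : A → ℚ) xs → Σl (λ x → c Q.* f x) xs ≡ c Q.* Σl f xs
  Σl-* c f [] = sym (QP.*-zeroʳ c)
  Σl-* c f (x ∷ xs) = trans (cong (c Q.* f x Q.+_) (Σl-* c f xs)) (sym (QP.*-distribˡ-+ c (f x) (Σl f xs)))

  Σl-neg : ∀ {A : Set} (f : A → ℚ) xs → Σl (λ x → Q.- f x) xs ≡ Q.- Σl f xs
  Σl-neg f [] = refl
  Σl-neg f (x ∷ xs) = trans (cong (Q.- f x Q.+_) (Σl-neg f xs)) (sym (QP.neg-distrib-+ (f x) (Σl f xs)))

  Σl-swap : ∀ {A B : Set} (f : A → B → ℚ) xs ys → Σl (λ x → Σl (f x) ys) xs ≡ Σl (λ y → Σl (λ x → f x y) xs) ys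
  Σl-swap f [] ys = sym (trans (Σl-cong (λ _ → refl) ys) (z ys))
    where
    z : ∀ ys → Σl (λ y → 0ℚ) ys ≡ 0ℚ
    z [] = refl
    z (_ ∷ ys) = trans (QP.+-identityˡ _) (z ys)
  Σl-swap f (x ∷ xs) ys = trans (cong (Σl (f x) ys Q.+_) (Σl-swap f xs ys)) (sym (Σl-+ (f x) (λ y → Σl (λ x' → f x' y) xs) ys))

  Σl-filter : ∀ {A : Set} {P : A → Set} (P? : ∀ x → Dec (P x)) (f : A → ℚ) xs →
    Σl f xs ≡ Σl f (filter P? xs) Q.+ Σl f (filter (λ x → ¬? (P? x)) xs)
  Σl-filter P? f [] = refl
  Σl-filter P? f (x ∷ xs) with P? x
  ... | yes _ = trans (cong (f x Q.+_) (Σl-filter P? f xs)) (sym (QP.+-assoc (f x) _ _))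
  ... | no _ = trans (cong (f x Q.+_) (Σl-filter P? f xs)) (lem (f x) (Σl f (filter P? xs)) (Σl f (filter (λ x → ¬? (P? x)) xs)))
    where
    lem : ∀ a b c → a Q.+ (b Q.+ c) ≡ b Q.+ (a Q.+ c)
    lem = solve 3 (λ a b c → a :+ (b :+ c) := b :+ (a :+ c)) refl

  mulT : ∀ {m} → Term m → Term m → Term m
  mulT t s = (proj₁ t Q.* proj₁ s , zipWith ℕ._+_ (proj₂ t) (proj₂ s))

  coeff-++ : ∀ {m} (p q : Poly m) u → coeff (p ++ q) u ≡ coeff p u Q.+ coeff q u
  coeff-++ p q u = trans (coeff-LF (p ++ q) u) (trans (Σl-++ _ p q) (sym (cong₂ Q._+_ (coeff-LF p u) (coeff-LF q u))))

  LF-++ : ∀ {m} (p q : Poly m) G → LF (p ++ q) G ≡ LF p G Q.+ LF q G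
  LF-++ p q G = Σl-++ _ p q

  LF-neg : ∀ {m} (p : Poly m) G → LF (-P p) G ≡ Q.- LF p G
  LF-neg p G = trans (Σl-map _ _ p) (trans (Σl-cong (λ t → sym (QP.neg-distribˡ-* (proj₁ t) (G (proj₂ t)))) p) (Σl-neg _ p))

  coeff-neg : ∀ {m} (p : Poly m) u → coeff (-P p) u ≡ Q.- coeff p u
  coeff-neg p u = trans (coeff-LF (-P p) u) (trans (LF-neg p _) (cong Q.-_ (sym (coeff-LF p u))))

  coeff-mul : ∀ {m} (p q : Poly m) u → coeff (p *P q) u ≡ Σl (λ t → Σl (λ s → proj₁ (mulT t s) Q.* δ (proj₂ (mulT t s)) u) q) p
  coeff-mul p q u = trans (coeff-LF (p *P q) u) (trans (Σl-concatMap _ _ p) (Σl-cong (λ t → Σl-map _ _ q) p))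

  module _ {m : ℕ} (v : Mono m) where
    P? : (t : Term m) → Dec (proj₂ t ≡ v)
    P? t = ≡-dec ℕ._≟_ (proj₂ t) v

    nP? : (t : Term m) → Dec (¬ (proj₂ t ≡ v))
    nP? t = ¬? (P? t)

    LF-filt : ∀ (r : Poly m) G → LF (filter P? r) G ≡ Σl proj₁ (filter P? r) Q.* G v
    LF-filt [] G = sym (QP.*-zeroˡ (G v))
    LF-filt ((a , w) ∷ r) G with P? (a , w)
    ... | yes refl = trans (cong (a Q.* G w Q.+_) (LF-filt r G)) (sym (QP.*-distribʳ-+ (G w) a _))
    ... | no _ = LF-filt r G

    δ-self : δ v v ≡ 1ℚ
    δ-self with ≡-dec ℕ._≟_ v v
    ... | yes _ = refl
    ... | no ne = ⊥-elim (ne refl)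

    δ-ne : ∀ w → ¬ (w ≡ v) → δ w v ≡ 0ℚ
    δ-ne w ne with ≡-dec ℕ._≟_ w v
    ... | yes e = ⊥-elim (ne e)
    ... | no _ = refl

    LF-nfilt : ∀ (r : Poly m) → LF (filter nP? r) (λ w → δ w v) ≡ 0ℚ
    LF-nfilt [] = refl
    LF-nfilt ((a , w) ∷ r) with P? (a , w)
    ... | yes _ = LF-nfilt r
    ... | no ne = trans (cong₂ Q._+_ (trans (cong (a Q.*_) (δ-ne w ne)) (QP.*-zeroʳ a)) (LF-nfilt r)) refl

  -- Induction on its length: the terms
  -- with the exponent of the head cancel, and the remaining ones again have zero
  -- coefficients.
  LF-zero : ∀ {m} k (p : Poly m) → length p ℕ.≤ k → (∀ u → coeff p u ≡ 0ℚ) → ∀ G → LF p G ≡ 0ℚ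
  LF-zero k [] _ _ G = refl
  LF-zero (suc k) ((a , v) ∷ r) (ℕ.s≤s len) h G = goal
    where
    r₁ = filter (P? v) r
    r₂ = filter (nP? v) r
    W = Σl proj₁ r₁
    split : ∀ H → LF r H ≡ LF r₁ H Q.+ LF r₂ H
    split H = Σl-filter (P? v) _ r
    coeffp : ∀ u → coeff ((a , v) ∷ r) u ≡ (a Q.+ W) Q.* δ v u Q.+ coeff r₂ u
    coeffp u = begin
        coeff ((a , v) ∷ r) u
      ≡⟨ coeff-cons a v r u ⟩
        a Q.* δ v u Q.+ coeff r u
      ≡⟨ cong (a Q.* δ v u Q.+_) (trans (coeff-LF r u) (trans (split _) (cong₂ Q._+_ (LF-filt v r _) (sym (coeff-LF r₂ u))))) ⟩
        a Q.* δ v u Q.+ (W Q.* δ v u Q.+ coeff r₂ u)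
      ≡⟨ sym (QP.+-assoc (a Q.* δ v u) _ _) ⟩
        (a Q.* δ v u Q.+ W Q.* δ v u) Q.+ coeff r₂ u
      ≡⟨ cong (Q._+ coeff r₂ u) (sym (QP.*-distribʳ-+ (δ v u) a W)) ⟩
        (a Q.+ W) Q.* δ v u Q.+ coeff r₂ u ∎
      where open ≡-Reasoning
    r₂v : coeff r₂ v ≡ 0ℚ
    r₂v = trans (coeff-LF r₂ v) (LF-nfilt v r)
    aW : a Q.+ W ≡ 0ℚ
    aW = begin
        a Q.+ W
      ≡⟨ sym (QP.*-identityʳ _) ⟩
        (a Q.+ W) Q.* 1ℚ
      ≡⟨ cong ((a Q.+ W) Q.*_) (sym (δ-self v)) ⟩
        (a Q.+ W) Q.* δ v v
      ≡⟨ sym (QP.+-identityʳ _) ⟩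
        (a Q.+ W) Q.* δ v v Q.+ 0ℚ
      ≡⟨ cong ((a Q.+ W) Q.* δ v v Q.+_) (sym r₂v) ⟩
        (a Q.+ W) Q.* δ v v Q.+ coeff r₂ v
      ≡⟨ sym (coeffp v) ⟩
        coeff ((a , v) ∷ r) v
      ≡⟨ h v ⟩
        0ℚ ∎
      where open ≡-Reasoning
    h₂ : ∀ u → coeff r₂ u ≡ 0ℚ
    h₂ u = begin
        coeff r₂ u
      ≡⟨ sym (QP.+-identityˡ _) ⟩
        0ℚ Q.+ coeff r₂ u
      ≡⟨ cong (Q._+ coeff r₂ u) (sym (QP.*-zeroˡ (δ v u))) ⟩
        0ℚ Q.* δ v u Q.+ coeff r₂ u
      ≡⟨ cong (λ z → z Q.* δ v u Q.+ coeff r₂ u) (sym aW) ⟩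
        (a Q.+ W) Q.* δ v u Q.+ coeff r₂ u
      ≡⟨ sym (coeffp u) ⟩
        coeff ((a , v) ∷ r) u
      ≡⟨ h u ⟩
        0ℚ ∎
      where open ≡-Reasoning
    goal : LF ((a , v) ∷ r) G ≡ 0ℚ
    goal = begin
        a Q.* G v Q.+ LF r G
      ≡⟨ cong (a Q.* G v Q.+_) (trans (split G) (cong (Q._+ LF r₂ G) (LF-filt v r G))) ⟩
        a Q.* G v Q.+ (W Q.* G v Q.+ LF r₂ G)
      ≡⟨ sym (QP.+-assoc (a Q.* G v) _ _) ⟩
        (a Q.* G v Q.+ W Q.* G v) Q.+ LF r₂ G
      ≡⟨ cong (Q._+ LF r₂ G) (trans (sym (QP.*-distribʳ-+ (G v) a W)) (trans (cong (Q._* G v) aW) (QP.*-zeroˡ (G v)))) ⟩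
        0ℚ Q.+ LF r₂ G
      ≡⟨ QP.+-identityˡ _ ⟩
        LF r₂ G
      ≡⟨ LF-zero k r₂ (NP.≤-trans (LP.length-filter (nP? v) r) len) h₂ G ⟩
        0ℚ ∎
      where open ≡-Reasoning

  private
    x-y≡0 : ∀ x y → x Q.+ Q.- y ≡ 0ℚ → x ≡ y
    x-y≡0 x y e = begin
        x
      ≡⟨ lem x y ⟩
        (x Q.+ Q.- y) Q.+ y
      ≡⟨ cong (Q._+ y) e ⟩
        0ℚ Q.+ y
      ≡⟨ QP.+-identityˡ y ⟩
        y ∎
      where open ≡-Reasoning
            lem : ∀ x y → x ≡ (x Q.+ Q.- y) Q.+ y
            lem = solve 2 (λ x y → x := (x :+ :- y) :+ y) refl

  LF-cong : ∀ {m} (p q : Poly m) → p ≈P q → ∀ G → LF p G ≡ LF q G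
  LF-cong p q h G = x-y≡0 _ _ (trans (sym (trans (LF-++ p (-P q) G) (cong (LF p G Q.+_) (LF-neg q G))))
    (LF-zero _ (p ++ (-P q)) NP.≤-refl (λ u → trans (coeff-++ p (-P q) u) (trans (cong (coeff p u Q.+_) (coeff-neg q u)) (trans (cong (Q._+ Q.- coeff q u) (h u)) (QP.+-inverseʳ (coeff q u))))) G))

  zipWith-comm+ : ∀ {m} (v w : Mono m) → zipWith ℕ._+_ v w ≡ zipWith ℕ._+_ w v
  zipWith-comm+ = VP.zipWith-comm NP.+-comm

  zipWith-assoc+ : ∀ {m} (v w z : Mono m) → zipWith ℕ._+_ (zipWith ℕ._+_ v w) z ≡ zipWith ℕ._+_ v (zipWith ℕ._+_ w z)
  zipWith-assoc+ = VP.zipWith-assoc NP.+-assoc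

  zipWith-idˡ+ : ∀ {m} (v : Mono m) → zipWith ℕ._+_ (replicate m 0) v ≡ v
  zipWith-idˡ+ = VP.zipWith-identityˡ NP.+-identityˡ

  -- Hq q u v is the coefficient of u in (monomial v) · q, so that
  -- coeff (p *P q) u is the functional LF p (Hq q u).
  Hq : ∀ {m} → Poly m → Mono m → Mono m → ℚ
  Hq q u v = Σl (λ s → proj₁ s Q.* δ (zipWith ℕ._+_ v (proj₂ s)) u) q

  coeff-mul-LF : ∀ {m} (p q : Poly m) u → coeff (p *P q) u ≡ LF p (Hq q u)
  coeff-mul-LF p q u = trans (coeff-mul p q u) (Σl-cong (λ t → trans (Σl-cong (λ s → QP.*-assoc (proj₁ t) (proj₁ s) _) q) (Σl-* (proj₁ t) _ q)) p)

  -- Ring laws for _*P_ up to _≈P_; congruence on the left is where LF-cong is needed.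
  *P-congˡ : ∀ {m} {p p' : Poly m} (q : Poly m) → p ≈P p' → (p *P q) ≈P (p' *P q)
  *P-congˡ {p = p} {p'} q h u = trans (coeff-mul-LF p q u) (trans (LF-cong p p' h _) (sym (coeff-mul-LF p' q u)))

  *P-comm : ∀ {m} (p q : Poly m) → (p *P q) ≈P (q *P p)
  *P-comm p q u = trans (coeff-mul p q u) (trans (Σl-swap _ p q) (trans (Σl-cong (λ s → Σl-cong (λ t →
    cong₂ Q._*_ (QP.*-comm (proj₁ t) (proj₁ s)) (cong (λ z → δ z u) (zipWith-comm+ (proj₂ t) (proj₂ s)))) p) q) (sym (coeff-mul q p u))))

  *P-congʳ : ∀ {m} (p : Poly m) {q q' : Poly m} → q ≈P q' → (p *P q) ≈P (p *P q')
  *P-congʳ p {q} {q'} h u = trans (*P-comm p q u) (trans (*P-congˡ {p = q} {p' = q'} p h u) (*P-comm q' p u))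

  *P-assoc : ∀ {m} (p q r : Poly m) → ((p *P q) *P r) ≈P (p *P (q *P r))
  *P-assoc p q r u = trans (coeff-mul (p *P q) r u) (trans (Σl-concatMap _ _ p) (trans (Σl-cong (λ t → trans (Σl-map _ _ q)
    (Σl-cong (λ s → Σl-cong (λ z → cong₂ Q._*_ (QP.*-assoc (proj₁ t) (proj₁ s) (proj₁ z)) (cong (λ w → δ w u) (zipWith-assoc+ (proj₂ t) (proj₂ s) (proj₂ z)))) r) q)) p)
    (sym (trans (coeff-mul p (q *P r) u) (Σl-cong (λ t → trans (Σl-concatMap _ _ q) (Σl-cong (λ s → Σl-map _ _ r) q)) p)))))

  *P-identityˡ : ∀ {m} (p : Poly m) → (constP 1ℚ *P p) ≈P p
  *P-identityˡ p u = trans (coeff-mul (constP 1ℚ) p u) (trans (QP.+-identityʳ _) (trans (Σl-cong (λ s →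
    cong₂ Q._*_ (QP.*-identityˡ (proj₁ s)) (cong (λ w → δ w u) (zipWith-idˡ+ (proj₂ s)))) p) (sym (coeff-LF p u))))

  *P-distribˡ : ∀ {m} (p q r : Poly m) → (p *P (q +P r)) ≈P ((p *P q) +P (p *P r))
  *P-distribˡ p q r u = trans (coeff-mul p (q ++ r) u) (trans (Σl-cong (λ t → Σl-++ _ q r) p) (trans (Σl-+ _ _ p)
    (sym (trans (coeff-++ (p *P q) (p *P r) u) (cong₂ Q._+_ (coeff-mul p q u) (coeff-mul p r u))))))

  *P-distribʳ : ∀ {m} (p q r : Poly m) → ((q +P r) *P p) ≈P ((q *P p) +P (r *P p))
  *P-distribʳ p q r u = trans (coeff-mul (q ++ r) p u) (trans (Σl-++ _ q r)
    (sym (trans (coeff-++ (q *P p) (r *P p) u) (cong₂ Q._+_ (coeff-mul q p u) (coeff-mul r p u)))))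

  ≈P-isEquivalence : ∀ {m} → IsEquivalence (_≈P_ {m})
  ≈P-isEquivalence = record { refl = λ _ → refl ; sym = λ h u → sym (h u) ; trans = λ h g u → trans (h u) (g u) }

  0P : ∀ {m} → Poly m
  0P = []

  +P-cong : ∀ {m} {p p' q q' : Poly m} → p ≈P p' → q ≈P q' → (p +P q) ≈P (p' +P q')
  +P-cong {p = p} {p'} {q} {q'} h g u = trans (coeff-++ p q u) (trans (cong₂ Q._+_ (h u) (g u)) (sym (coeff-++ p' q' u)))

  +P-assoc : ∀ {m} (p q r : Poly m) → ((p +P q) +P r) ≈P (p +P (q +P r))
  +P-assoc p q r u rewrite LP.++-assoc p q r = refl

  +P-comm : ∀ {m} (p q : Poly m) → (p +P q) ≈P (q +P p)
  +P-comm p q u = trans (coeff-++ p q u) (trans (QP.+-comm (coeff p u) (coeff q u)) (sym (coeff-++ q p u)))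

  +P-identityˡ : ∀ {m} (p : Poly m) → (0P +P p) ≈P p
  +P-identityˡ p u = refl

  +P-identityʳ : ∀ {m} (p : Poly m) → (p +P 0P) ≈P p
  +P-identityʳ p u = trans (coeff-++ p [] u) (QP.+-identityʳ (coeff p u))

  -P-inverseˡ : ∀ {m} (p : Poly m) → ((-P p) +P p) ≈P 0P
  -P-inverseˡ p u = trans (coeff-++ (-P p) p u) (trans (cong (Q._+ coeff p u) (coeff-neg p u)) (QP.+-inverseˡ (coeff p u)))

  -P-inverseʳ : ∀ {m} (p : Poly m) → (p +P (-P p)) ≈P 0P
  -P-inverseʳ p u = trans (coeff-++ p (-P p) u) (trans (cong (coeff p u Q.+_) (coeff-neg p u)) (QP.+-inverseʳ (coeff p u)))

  -P-cong : ∀ {m} {p q : Poly m} → p ≈P q → (-P p) ≈P (-P q)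
  -P-cong {p = p} {q} h u = trans (coeff-neg p u) (trans (cong Q.-_ (h u)) (sym (coeff-neg q u)))

  *P-cong : ∀ {m} {p p' q q' : Poly m} → p ≈P p' → q ≈P q' → (p *P q) ≈P (p' *P q')
  *P-cong {p = p} {p'} {q} {q'} h g u = trans (*P-congˡ {p = p} {p' = p'} q h u) (*P-congʳ p' g u)

  -- Formal sums modulo _≈P_ form a commutative ring; this lets us use the ring solver.
  PolyRing : ℕ → CommutativeRing _ _
  PolyRing m = record
    { Carrier = Poly m ; _≈_ = _≈P_ ; _+_ = _+P_ ; _*_ = _*P_ ; -_ = -P_ ; 0# = 0P ; 1# = constP 1ℚ
    ; isCommutativeRing = record
      { isRing = record
        { +-isAbelianGroup = record
          { isGroup = record
            { isMonoid = record
              { isSemigroup = record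
                { isMagma = record { isEquivalence = ≈P-isEquivalence ; ∙-cong = λ {p} {p'} {q} {q'} → +P-cong {p = p} {p'} {q} {q'} }
                ; assoc = +P-assoc }
              ; identity = +P-identityˡ , +P-identityʳ }
            ; inverse = -P-inverseˡ , -P-inverseʳ
            ; ⁻¹-cong = λ {p} {q} → -P-cong {p = p} {q} }
          ; comm = +P-comm }
        ; *-cong = λ {p} {p'} {q} {q'} → *P-cong {p = p} {p'} {q} {q'}
        ; *-assoc = *P-assoc
        ; *-identity = *P-identityˡ , (λ p → λ u → trans (*P-comm p (constP 1ℚ) u) (*P-identityˡ p u))
        ; distrib = *P-distribˡ , *P-distribʳ }
      ; *-comm = *P-comm } }

  *L : ∀ {m} (p p' q : Poly m) → p ≈P p' → (p *P q) ≈P (p' *P q)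
  *L p p' q h = *P-congˡ {p = p} {p' = p'} q h

  *R : ∀ {m} (p q q' : Poly m) → q ≈P q' → (p *P q) ≈P (p *P q')
  *R p q q' h = *P-congʳ p {q} {q'} h

  +R : ∀ {m} (p q q' : Poly m) → q ≈P q' → (p +P q) ≈P (p +P q')
  +R p q q' h = +P-cong {p = p} {p} {q} {q'} (λ _ → refl) h

  -- Constants form a ring homomorphism ℚ → Poly m (needed for the ring solver).
  constP-coeff : ∀ {m} a (u : Mono m) → coeff (constP a) u ≡ a Q.* δ (replicate m 0) u
  constP-coeff {m} a u = trans (coeff-cons a (replicate m 0) [] u) (QP.+-identityʳ (a Q.* δ (replicate m 0) u))

  const-+ : ∀ {m} a b → constP {m} (a Q.+ b) ≈P (constP a +P constP b)
  const-+ {m} a b u = trans (constP-coeff {m} (a Q.+ b) u) (trans (QP.*-distribʳ-+ (δ (replicate m 0) u) a b)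
    (sym (trans (coeff-++ (constP a) (constP b) u) (cong₂ Q._+_ (constP-coeff {m} a u) (constP-coeff {m} b u)))))

  const-* : ∀ {m} a b → constP {m} (a Q.* b) ≈P (constP a *P constP b)
  const-* {m} a b u = sym (trans (coeff-cons (a Q.* b) (zipWith ℕ._+_ (replicate m 0) (replicate m 0)) [] u) (trans (QP.+-identityʳ (a Q.* b Q.* δ (zipWith ℕ._+_ (replicate m 0) (replicate m 0)) u))
    (trans (cong (λ z → a Q.* b Q.* δ z u) (zipWith-idˡ+ (replicate m 0))) (sym (constP-coeff {m} (a Q.* b) u)))))

  const-0 : ∀ {m} → constP {m} 0ℚ ≈P 0P
  const-0 {m} u = trans (constP-coeff {m} 0ℚ u) (QP.*-zeroˡ (δ (replicate m 0) u))

module Measures where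

  open Polynomials
  open import Data.Nat as ℕ using (ℕ; zero; suc; _≤_; _⊔_; _+_; _*_)
  import Data.Nat.Properties as NP
  open import Data.Nat.Solver using (module +-*-Solver)
  open import Data.Fin using (Fin; zero; suc)
  open import Data.Vec as V using (Vec; replicate; zipWith; lookup)
  open import Data.Vec.Properties using (≡-dec)
  open import Data.List using (List; []; _∷_; map; foldr; length; tabulate; allFin; deduplicate)
  import Data.List.Properties as LP
  open import Data.List.Relation.Unary.All as All using (All; []; _∷_)
  import Data.List.Relation.Unary.All.Properties as AllP
  open import Data.List.Membership.Propositional using (_∈_)
  import Data.List.Membership.Propositional.Properties as MP
  open import Data.Product using (_,_; proj₁; proj₂)
  open import Data.Bool using (Bool; if_then_else_)
  open import Data.Rational as Q using (0ℚ; 1ℚ)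
  open import Relation.Binary.PropositionalEquality
  open import Relation.Nullary using (¬?)

  -- FR h S e folds h over the elements of the subset S (as a vector), structurally
  -- in S; the folds over allFin in Defs (sumOver, prodOver, …) are FR's.
  FR : ∀ {X : Set} {k} → (Fin k → X → X) → Vec Bool k → X → X
  FR h V.[] e = e
  FR h (b V.∷ S) e = if b then h zero (FR (λ i → h (suc i)) S e) else FR (λ i → h (suc i)) S e

  stepF : ∀ {X : Set} {k} → (Fin k → X → X) → Vec Bool k → Fin k → X → X
  stepF h S i acc = if lookup S i then h i acc else acc

  private
    tab-shift : ∀ {X : Set} {k j} (h : Fin (suc k) → X → X) b (S : Vec Bool k) e (t : Fin j → Fin k) →
      foldr (stepF h (b V.∷ S)) e (tabulate (λ i → suc (t i))) ≡ foldr (stepF (λ i → h (suc i)) S) e (tabulate t)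
    tab-shift {j = zero} h b S e t = refl
    tab-shift {j = suc j} h b S e t = cong (stepF h (b V.∷ S) (suc (t zero))) (tab-shift h b S e (λ i → t (suc i)))

  FR-allFin : ∀ {X : Set} {k} (h : Fin k → X → X) (S : Vec Bool k) e → foldr (stepF h S) e (allFin k) ≡ FR h S e
  FR-allFin h V.[] e = refl
  FR-allFin h (b V.∷ S) e = cong (stepF h (b V.∷ S) zero) (trans (tab-shift h b S e (λ i → i)) (FR-allFin (λ i → h (suc i)) S e))

  prodOver-FR : ∀ {m} (f : Fin m → Poly m) S → prodOver f S ≡ FR (λ i acc → f i *P acc) S (constP 1ℚ)
  prodOver-FR f S = FR-allFin (λ i acc → f i *P acc) S (constP 1ℚ)

  sumOver-FR : ∀ {m} (f : Fin m → Poly m) S → sumOver f S ≡ FR (λ i acc → f i +P acc) S []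
  sumOver-FR f S = FR-allFin (λ i acc → f i +P acc) S []

  length-*P : ∀ {m} (p q : Poly m) → length (p *P q) ≡ length p * length q
  length-*P [] q = refl
  length-*P (t ∷ p) q = trans (LP.length-++ (map (mulT t) q)) (cong₂ _+_ (LP.length-map (mulT t) q) (length-*P p q))

  length-+P : ∀ {m} (p q : Poly m) → length (p +P q) ≡ length p + length q
  length-+P p q = LP.length-++ p

  nTerms≤length : ∀ {m} (p : Poly m) → nTerms p ≤ length p
  nTerms≤length p = begin
    nTerms p                           ≤⟨ LP.length-filter (λ u → ¬? (coeff p u Q.≟ 0ℚ)) exps ⟩
    length exps                        ≤⟨ LP.length-deduplicate (≡-dec ℕ._≟_) (map proj₂ p) ⟩
    length (map proj₂ p)               ≡⟨ LP.length-map proj₂ p ⟩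
    length p                           ∎
    where
    open NP.≤-Reasoning
    exps = deduplicate (≡-dec ℕ._≟_) (map proj₂ p)

  deg : ∀ {m} → Mono m → ℕ
  deg u = V.foldr (λ _ → ℕ) _+_ 0 u

  DegLe : ∀ {m} → Poly m → ℕ → Set
  DegLe p r = All (λ t → deg (proj₂ t) ≤ r) p

  private
    foldr-max≤ : ∀ {m} r (us : List (Mono m)) → All (λ u → deg u ≤ r) us →
      foldr (λ u d → deg u ⊔ d) 0 us ≤ r
    foldr-max≤ r [] _ = ℕ.z≤n
    foldr-max≤ r (u ∷ us) (h ∷ hs) = NP.⊔-lub h (foldr-max≤ r us hs)

  degree≤ : ∀ {m} (p : Poly m) r → DegLe p r → degree p ≤ r
  degree≤ p r h = foldr-max≤ r (support p) (All.tabulate λ {u} u∈ → lem u (MP.∈-deduplicate⁻ _ _ (proj₁ (MP.∈-filter⁻ _ u∈))))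
    where
    lem : ∀ u → u ∈ map proj₂ p → deg u ≤ r
    lem u u∈ with MP.∈-map⁻ proj₂ u∈
    ... | t , t∈ , refl = All.lookup h t∈

  DegLe-mono : ∀ {m} {p : Poly m} {r s} → r ≤ s → DegLe p r → DegLe p s
  DegLe-mono r≤s = All.map (λ h → NP.≤-trans h r≤s)

  DegLe-++ : ∀ {m} {p q : Poly m} {r} → DegLe p r → DegLe q r → DegLe (p +P q) r
  DegLe-++ = AllP.++⁺

  deg-zipWith : ∀ {m} (v w : Mono m) → deg (zipWith _+_ v w) ≡ deg v + deg w
  deg-zipWith V.[] V.[] = refl
  deg-zipWith (x V.∷ v) (y V.∷ w) = trans (cong (x + y +_) (deg-zipWith v w)) (lem x y (deg v) (deg w))
    where
    lem : ∀ a b c d → a + b + (c + d) ≡ a + c + (b + d)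
    lem = solve 4 (λ a b c d → a :+ b :+ (c :+ d) := a :+ c :+ (b :+ d)) refl
      where open +-*-Solver

  DegLe-neg : ∀ {m} {p : Poly m} {r} → DegLe p r → DegLe (-P p) r
  DegLe-neg {p = []} [] = []
  DegLe-neg {p = t ∷ p} (h ∷ hs) = h ∷ DegLe-neg hs

  DegLe-* : ∀ {m} {p q : Poly m} {r s} → DegLe p r → DegLe q s → DegLe (p *P q) (r + s)
  DegLe-* {p = []} [] hq = []
  DegLe-* {p = t ∷ p} {q} {r} {s} (h ∷ hp) hq = AllP.++⁺ (lem q hq) (DegLe-* hp hq)
    where
    lem : ∀ q → DegLe q s → DegLe (map (mulT t) q) (r + s)
    lem [] [] = []
    lem (x ∷ q) (g ∷ gs) = subst (_≤ r + s) (sym (deg-zipWith (proj₂ t) (proj₂ x))) (NP.+-mono-≤ h g) ∷ lem q gs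

  deg-replicate0 : ∀ m → deg (replicate m 0) ≡ 0
  deg-replicate0 zero = refl
  deg-replicate0 (suc m) = deg-replicate0 m

  DegLe-const : ∀ {m} c → DegLe {m} (constP c) 0
  DegLe-const {m} c = NP.≤-reflexive (deg-replicate0 m) ∷ []

  deg-unit : ∀ {m} (i : Fin m) → deg (replicate m 0 V.[ i ]≔ 1) ≡ 1
  deg-unit {suc m} zero = cong suc (deg-replicate0 m)
  deg-unit {suc m} (suc i) = deg-unit i

  DegLe-var : ∀ {m} (i : Fin m) → DegLe (varP i) 1
  DegLe-var i = NP.≤-reflexive (deg-unit i) ∷ []

module SubsetProducts where

  open Polynomials
  open Measures
  open import Data.Nat using (ℕ; _+_; _*_; _^_)
  import Data.Nat.Properties as NP
  open import Data.Fin using (Fin; zero; suc; _↑ˡ_; _↑ʳ_)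
  open import Data.Fin.Subset using (⁅_⁆; _∪_; ∣_∣)
  open import Data.Fin.Subset.Properties using (∪-identityʳ)
  open import Data.Vec using (Vec; []; _∷_; lookup; _++_)
  open import Data.List using (length)
  open import Data.Bool using (Bool; true; false)
  open import Data.Rational using (1ℚ)
  open import Relation.Binary.PropositionalEquality using (_≡_; refl; sym; trans; cong; cong₂)
  open import Algebra.Bundles using (CommutativeRing)

  module _ {m : ℕ} where
    open CommutativeRing (PolyRing m) using (setoid)
    open import Relation.Binary.Reasoning.Setoid setoid

    ΠF : ∀ {k} → (Fin k → Poly m) → Vec Bool k → Poly m → Poly m
    ΠF f S e = FR (λ i acc → f i *P acc) S e

    ΠF-cong : ∀ {k} (f : Fin k → Poly m) S {e e'} → e ≈P e' → ΠF f S e ≈P ΠF f S e'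
    ΠF-cong f [] h = h
    ΠF-cong f (true ∷ S) h = *P-congʳ (f zero) (ΠF-cong (λ i → f (suc i)) S h)
    ΠF-cong f (false ∷ S) h = ΠF-cong (λ i → f (suc i)) S h

    ΠF-base : ∀ {k} (f : Fin k → Poly m) S g e → ΠF f S (g *P e) ≈P (g *P ΠF f S e)
    ΠF-base f [] g e = λ u → refl
    ΠF-base f (true ∷ S) g e = begin
        f zero *P ΠF (λ i → f (suc i)) S (g *P e)
      ≈⟨ *P-congʳ (f zero) (ΠF-base (λ i → f (suc i)) S g e) ⟩
        f zero *P (g *P ΠF (λ i → f (suc i)) S e)
      ≈⟨ (λ u → sym (*P-assoc (f zero) g _ u)) ⟩
        (f zero *P g) *P ΠF (λ i → f (suc i)) S e
      ≈⟨ *L (f zero *P g) (g *P f zero) _ (*P-comm (f zero) g) ⟩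
        (g *P f zero) *P ΠF (λ i → f (suc i)) S e
      ≈⟨ *P-assoc g (f zero) _ ⟩
        g *P (f zero *P ΠF (λ i → f (suc i)) S e) ∎
    ΠF-base f (false ∷ S) g e = ΠF-base (λ i → f (suc i)) S g e

    ΠF-insert : ∀ {k} (f : Fin k → Poly m) S (i : Fin k) e → lookup S i ≡ false →
      ΠF f (S ∪ ⁅ i ⁆) e ≈P (f i *P ΠF f S e)
    ΠF-insert f (false ∷ S) zero e refl rewrite ∪-identityʳ S = λ u → refl
    ΠF-insert f (b ∷ S) (suc i) e h with b
    ... | false = ΠF-insert (λ j → f (suc j)) S i e h
    ... | true = begin
        f zero *P ΠF (λ j → f (suc j)) (S ∪ ⁅ i ⁆) e
      ≈⟨ *P-congʳ (f zero) (ΠF-insert (λ j → f (suc j)) S i e h) ⟩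
        f zero *P (f (suc i) *P ΠF (λ j → f (suc j)) S e)
      ≈⟨ (λ u → sym (*P-assoc (f zero) (f (suc i)) _ u)) ⟩
        (f zero *P f (suc i)) *P ΠF (λ j → f (suc j)) S e
      ≈⟨ *L (f zero *P f (suc i)) (f (suc i) *P f zero) _ (*P-comm (f zero) (f (suc i))) ⟩
        (f (suc i) *P f zero) *P ΠF (λ j → f (suc j)) S e
      ≈⟨ *P-assoc (f (suc i)) (f zero) _ ⟩
        f (suc i) *P (f zero *P ΠF (λ j → f (suc j)) S e) ∎

    ΠF-++ : ∀ {a b} (f : Fin (a + b) → Poly m) (N : Vec Bool a) (P : Vec Bool b) e →
      ΠF f (N ++ P) e ≡ ΠF (λ i → f (i ↑ˡ b)) N (ΠF (λ i → f (a ↑ʳ i)) P e)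
    ΠF-++ f [] P e = refl
    ΠF-++ {suc a} {b} f (true ∷ N) P e = cong (f zero *P_) (ΠF-++ (λ i → f (suc i)) N P e)
    ΠF-++ {suc a} {b} f (false ∷ N) P e = ΠF-++ (λ i → f (suc i)) N P e

    ΠF-length1 : ∀ {k} (f : Fin k → Poly m) S e → (∀ i → length (f i) ≡ 1) → length (ΠF f S e) ≡ length e
    ΠF-length1 f [] e h = refl
    ΠF-length1 f (true ∷ S) e h = trans (length-*P (f zero) _) (trans (cong₂ _*_ (h zero) (ΠF-length1 (λ i → f (suc i)) S e (λ i → h (suc i)))) (NP.*-identityˡ _))
    ΠF-length1 f (false ∷ S) e h = ΠF-length1 (λ i → f (suc i)) S e (λ i → h (suc i))

    ΠF-length2 : ∀ {k} (f : Fin k → Poly m) S e → (∀ i → length (f i) ≡ 2) → length (ΠF f S e) ≡ 2 ^ ∣ S ∣ * length e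
    ΠF-length2 f [] e h = sym (NP.*-identityˡ _)
    ΠF-length2 f (true ∷ S) e h = trans (length-*P (f zero) _) (trans (cong₂ _*_ (h zero) (ΠF-length2 (λ i → f (suc i)) S e (λ i → h (suc i)))) (sym (NP.*-assoc 2 (2 ^ ∣ S ∣) _)))
    ΠF-length2 f (false ∷ S) e h = ΠF-length2 (λ i → f (suc i)) S e (λ i → h (suc i))

    ΠF-deg : ∀ {k} (f : Fin k → Poly m) S e r → (∀ i → DegLe (f i) 1) → DegLe e r → DegLe (ΠF f S e) (∣ S ∣ + r)
    ΠF-deg f [] e r h he = he
    ΠF-deg f (true ∷ S) e r h he = DegLe-* (h zero) (ΠF-deg (λ i → f (suc i)) S e r (λ i → h (suc i)) he)
    ΠF-deg f (false ∷ S) e r h he = ΠF-deg (λ i → f (suc i)) S e r (λ i → h (suc i)) he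

module ClauseAlgebra where

  open import Data.Nat as ℕ using (ℕ; suc; _≤_; _+_)
  import Data.Nat.Properties as NP
  open import Data.Fin using (Fin; zero; suc)
  import Data.Fin.Properties as FP
  open import Data.Fin.Subset using (Subset; ⁅_⁆; _∪_; ∣_∣; _⊆_) renaming (⊥ to ∅)
  open import Data.Fin.Subset.Properties using (∪-identityʳ)
  open import Data.Vec using (Vec; []; _∷_; lookup; tabulate; _[_]≔_)
  import Data.Vec.Properties as VP
  open import Data.List as L using (List; []; _∷_; allFin)
  open import Data.List.Relation.Unary.Any using (here; there)
  open import Data.List.Membership.Propositional using (_∈_)
  import Data.List.Membership.Propositional.Properties as MP
  open import Data.Bool using (Bool; true; false; _∨_; if_then_else_)
  open import Data.Bool.Properties using (∨-zeroʳ; ∨-identityʳ)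
  open import Data.Product using (_,_)
  open import Relation.Binary.PropositionalEquality
  open import Relation.Nullary using (¬_; yes; no; Dec)
  open import Data.Empty using (⊥-elim)

  V-ext : ∀ {k} (S T : Vec Bool k) → (∀ i → lookup S i ≡ lookup T i) → S ≡ T
  V-ext S T h = begin
    S                   ≡⟨ VP.tabulate∘lookup S ⟨
    tabulate (lookup S) ≡⟨ VP.tabulate-cong h ⟩
    tabulate (lookup T) ≡⟨ VP.tabulate∘lookup T ⟩
    T                   ∎
    where open ≡-Reasoning

  lookup-∅ : ∀ {k} (i : Fin k) → lookup (∅ {k}) i ≡ false
  lookup-∅ zero = refl
  lookup-∅ (suc i) = lookup-∅ i

  lookup-∪ : ∀ {k} (S T : Subset k) i → lookup (S ∪ T) i ≡ lookup S i ∨ lookup T i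
  lookup-∪ (a ∷ S) (b ∷ T) zero = refl
  lookup-∪ (a ∷ S) (b ∷ T) (suc i) = lookup-∪ S T i

  lookup-⁅⁆-self : ∀ {k} (i : Fin k) → lookup ⁅ i ⁆ i ≡ true
  lookup-⁅⁆-self zero = refl
  lookup-⁅⁆-self (suc i) = lookup-⁅⁆-self i

  lookup-⁅⁆-other : ∀ {k} (i j : Fin k) → ¬ j ≡ i → lookup ⁅ i ⁆ j ≡ false
  lookup-⁅⁆-other zero zero ne = ⊥-elim (ne refl)
  lookup-⁅⁆-other zero (suc j) ne = lookup-∅ j
  lookup-⁅⁆-other (suc i) zero ne = refl
  lookup-⁅⁆-other (suc i) (suc j) ne = lookup-⁅⁆-other i j (λ e → ne (cong suc e))

  lookup-ins-self : ∀ {k} (S : Subset k) i → lookup (S ∪ ⁅ i ⁆) i ≡ true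
  lookup-ins-self S i = trans (lookup-∪ S ⁅ i ⁆ i) (trans (cong (lookup S i ∨_) (lookup-⁅⁆-self i)) (∨-zeroʳ (lookup S i)))

  lookup-ins-other : ∀ {k} (S : Subset k) i j → ¬ j ≡ i → lookup (S ∪ ⁅ i ⁆) j ≡ lookup S j
  lookup-ins-other S i j ne = trans (lookup-∪ S ⁅ i ⁆ j) (trans (cong (lookup S j ∨_) (lookup-⁅⁆-other i j ne)) (∨-identityʳ _))

  ins-mem : ∀ {k} (S : Subset k) i → lookup S i ≡ true → S ∪ ⁅ i ⁆ ≡ S
  ins-mem S i h = V-ext _ S λ j → case j
    where
    case : ∀ j → lookup (S ∪ ⁅ i ⁆) j ≡ lookup S j
    case j with j FP.≟ i
    ... | yes refl = trans (lookup-ins-self S j) (sym h)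
    ... | no ne = lookup-ins-other S i j ne

  card-ins : ∀ {k} (S : Subset k) i → lookup S i ≡ false → ∣ S ∪ ⁅ i ⁆ ∣ ≡ suc ∣ S ∣
  card-ins (false ∷ S) zero refl = cong suc (cong ∣_∣ (∪-identityʳ S))
  card-ins (true ∷ S) (suc i) h = cong suc (card-ins S i h)
  card-ins (false ∷ S) (suc i) h = card-ins S i h

  lookup-del-self : ∀ {k} (S : Subset k) i → lookup (S [ i ]≔ false) i ≡ false
  lookup-del-self S i = VP.lookup∘update i S false

  lookup-del-other : ∀ {k} (S : Subset k) i j → ¬ j ≡ i → lookup (S [ i ]≔ false) j ≡ lookup S j
  lookup-del-other S i j ne = VP.lookup∘update′ ne S false

  del-ins : ∀ {k} (S : Subset k) i → lookup S i ≡ true → (S [ i ]≔ false) ∪ ⁅ i ⁆ ≡ S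
  del-ins S i h = V-ext _ S λ j → case j
    where
    case : ∀ j → lookup ((S [ i ]≔ false) ∪ ⁅ i ⁆) j ≡ lookup S j
    case j with j FP.≟ i
    ... | yes refl = trans (lookup-ins-self (S [ i ]≔ false) j) (sym h)
    ... | no ne = trans (lookup-ins-other (S [ i ]≔ false) i j ne) (lookup-del-other S i j ne)

  card-del : ∀ {k} (S : Subset k) i → lookup S i ≡ true → suc ∣ S [ i ]≔ false ∣ ≡ ∣ S ∣
  card-del S i h = trans (sym (card-ins (S [ i ]≔ false) i (lookup-del-self S i))) (cong ∣_∣ (del-ins S i h))

  card-mono : ∀ {k} (S T : Subset k) → (∀ i → lookup S i ≡ true → lookup T i ≡ true) → ∣ S ∣ ≤ ∣ T ∣
  card-mono [] [] h = ℕ.z≤n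
  card-mono (true ∷ S) (true ∷ T) h = ℕ.s≤s (card-mono S T (λ i → h (suc i)))
  card-mono (true ∷ S) (false ∷ T) h with h zero refl
  ... | ()
  card-mono (false ∷ S) (true ∷ T) h = NP.m≤n⇒m≤1+n (card-mono S T (λ i → h (suc i)))
  card-mono (false ∷ S) (false ∷ T) h = card-mono S T (λ i → h (suc i))

  ⊆⇒lookup : ∀ {k} {S T : Subset k} → S ⊆ T → ∀ i → lookup S i ≡ true → lookup T i ≡ true
  ⊆⇒lookup {S = S} {T} h i e = VP.[]=⇒lookup (h (VP.lookup⇒[]= i S e))

  mem : ∀ {n} → Literal n → Clause n → Bool
  mem (pos i) (P , N) = lookup P i
  mem (neg i) (P , N) = lookup N i

  del : ∀ {n} → Clause n → Literal n → Clause n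
  del (P , N) (pos i) = (P [ i ]≔ false , N)
  del (P , N) (neg i) = (P , N [ i ]≔ false)

  _≟L_ : ∀ {n} (a b : Literal n) → Dec (a ≡ b)
  pos i ≟L pos j with i FP.≟ j
  ... | yes refl = yes refl
  ... | no ne = no λ { refl → ne refl }
  pos i ≟L neg j = no λ ()
  neg i ≟L pos j = no λ ()
  neg i ≟L neg j with i FP.≟ j
  ... | yes refl = yes refl
  ... | no ne = no λ { refl → ne refl }

  clause-ext : ∀ {n} (C D : Clause n) → (∀ ℓ → mem ℓ C ≡ mem ℓ D) → C ≡ D
  clause-ext (P , N) (P' , N') h = cong₂ _,_ (V-ext P P' (λ i → h (pos i))) (V-ext N N' (λ i → h (neg i)))

  mem-ins-self : ∀ {n} (C : Clause n) ℓ → mem ℓ (C ∨ₗ ℓ) ≡ true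
  mem-ins-self (P , N) (pos i) = lookup-ins-self P i
  mem-ins-self (P , N) (neg i) = lookup-ins-self N i

  mem-ins-other : ∀ {n} (C : Clause n) ℓ ℓ' → ¬ ℓ' ≡ ℓ → mem ℓ' (C ∨ₗ ℓ) ≡ mem ℓ' C
  mem-ins-other (P , N) (pos i) (pos j) ne = lookup-ins-other P i j (λ e → ne (cong pos e))
  mem-ins-other (P , N) (pos i) (neg j) ne = refl
  mem-ins-other (P , N) (neg i) (pos j) ne = refl
  mem-ins-other (P , N) (neg i) (neg j) ne = lookup-ins-other N i j (λ e → ne (cong neg e))

  mem-del-self : ∀ {n} (C : Clause n) ℓ → mem ℓ (del C ℓ) ≡ false
  mem-del-self (P , N) (pos i) = lookup-del-self P i
  mem-del-self (P , N) (neg i) = lookup-del-self N i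

  ins-mem-C : ∀ {n} (C : Clause n) ℓ → mem ℓ C ≡ true → C ∨ₗ ℓ ≡ C
  ins-mem-C (P , N) (pos i) h = cong (_, N) (ins-mem P i h)
  ins-mem-C (P , N) (neg i) h = cong (P ,_) (ins-mem N i h)

  del-ins-C : ∀ {n} (C : Clause n) ℓ → mem ℓ C ≡ true → del C ℓ ∨ₗ ℓ ≡ C
  del-ins-C (P , N) (pos i) h = cong (_, N) (del-ins P i h)
  del-ins-C (P , N) (neg i) h = cong (P ,_) (del-ins N i h)

  width-ins : ∀ {n} (C : Clause n) ℓ → mem ℓ C ≡ false → width (C ∨ₗ ℓ) ≡ suc (width C)
  width-ins (P , N) (pos i) h = cong (_+ ∣ N ∣) (card-ins P i h)
  width-ins (P , N) (neg i) h = trans (cong (∣ P ∣ +_) (card-ins N i h)) (NP.+-suc ∣ P ∣ ∣ N ∣)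

  width-del : ∀ {n} (C : Clause n) ℓ → mem ℓ C ≡ true → suc (width (del C ℓ)) ≡ width C
  width-del (P , N) (pos i) h = cong (_+ ∣ N ∣) (card-del P i h)
  width-del (P , N) (neg i) h = trans (sym (NP.+-suc ∣ P ∣ _)) (cong (∣ P ∣ +_) (card-del N i h))

  _⊑_ : ∀ {n} → Clause n → Clause n → Set
  U ⊑ V = ∀ ℓ → mem ℓ U ≡ true → mem ℓ V ≡ true

  width-mono : ∀ {n} (U V : Clause n) → U ⊑ V → width U ≤ width V
  width-mono (P , N) (P' , N') h = NP.+-mono-≤ (card-mono P P' (λ i → h (pos i))) (card-mono N N' (λ i → h (neg i)))

  ⊆c⇒⊑ : ∀ {n} (U V : Clause n) → U ⊆c V → U ⊑ V
  ⊆c⇒⊑ (P , N) (P' , N') (h , g) (pos i) = ⊆⇒lookup h i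
  ⊆c⇒⊑ (P , N) (P' , N') (h , g) (neg i) = ⊆⇒lookup g i

  mem-∨c : ∀ {n} (A B : Clause n) ℓ → mem ℓ (A ∨c B) ≡ mem ℓ A ∨ mem ℓ B
  mem-∨c (P , N) (P' , N') (pos i) = lookup-∪ P P' i
  mem-∨c (P , N) (P' , N') (neg i) = lookup-∪ N N' i

  mem-ins : ∀ {n} (C : Clause n) ℓ ℓ' → mem ℓ' C ≡ true → mem ℓ' (C ∨ₗ ℓ) ≡ true
  mem-ins C ℓ ℓ' h with ℓ' ≟L ℓ
  ... | yes refl = mem-ins-self C ℓ
  ... | no ne = trans (mem-ins-other C ℓ ℓ' ne) h

  all-lits : ∀ n → List (Literal n)
  all-lits n = L.map pos (allFin n) L.++ L.map neg (allFin n)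

  ∈-all-lits : ∀ {n} (ℓ : Literal n) → ℓ ∈ all-lits n
  ∈-all-lits (pos i) = MP.∈-++⁺ˡ (MP.∈-map⁺ pos (MP.∈-allFin i))
  ∈-all-lits {n} (neg i) = MP.∈-++⁺ʳ (L.map pos (allFin n)) (MP.∈-map⁺ neg (MP.∈-allFin i))

  width-ins≤ : ∀ {n} (C : Clause n) ℓ → width (C ∨ₗ ℓ) ≤ suc (width C)
  width-ins≤ C ℓ with mem ℓ C in e
  ... | true = subst (_≤ suc (width C)) (cong width (sym (ins-mem-C C ℓ e))) (NP.n≤1+n _)
  ... | false = NP.≤-reflexive (width-ins C ℓ e)

  ⊑-ins : ∀ {n} (U V : Clause n) ℓ → U ⊑ V → mem ℓ V ≡ true → (U ∨ₗ ℓ) ⊑ V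
  ⊑-ins U V ℓ h e ℓ' m with ℓ' ≟L ℓ
  ... | yes refl = e
  ... | no ne = h ℓ' (trans (sym (mem-ins-other U ℓ ℓ' ne)) m)

  grow : ∀ {n} → Clause n → List (Literal n) → Clause n → Clause n
  grow V [] U = U
  grow V (ℓ ∷ xs) U = grow V xs (if mem ℓ V then U ∨ₗ ℓ else U)

  g-mono : ∀ {n} (V : Clause n) xs U ℓ → mem ℓ U ≡ true → mem ℓ (grow V xs U) ≡ true
  g-mono V [] U ℓ h = h
  g-mono V (ℓ' ∷ xs) U ℓ h with mem ℓ' V
  ... | true = g-mono V xs (U ∨ₗ ℓ') ℓ (mem-ins U ℓ' ℓ h)
  ... | false = g-mono V xs U ℓ h

  g-sub : ∀ {n} (V : Clause n) xs U → U ⊑ V → grow V xs U ⊑ V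
  g-sub V [] U h = h
  g-sub V (ℓ' ∷ xs) U h with mem ℓ' V in e
  ... | true = g-sub V xs (U ∨ₗ ℓ') (⊑-ins U V ℓ' h e)
  ... | false = g-sub V xs U h

  g-hit : ∀ {n} (V : Clause n) xs U ℓ → ℓ ∈ xs → mem ℓ V ≡ true → mem ℓ (grow V xs U) ≡ true
  g-hit V (ℓ' ∷ xs) U ℓ (here refl) h rewrite h = g-mono V xs (U ∨ₗ ℓ) ℓ (mem-ins-self U ℓ)
  g-hit V (ℓ' ∷ xs) U ℓ (there p) h = g-hit V xs _ ℓ p h

  g-final : ∀ {n} (V U : Clause n) → U ⊑ V → grow V (all-lits n) U ≡ V
  g-final {n} V U h = clause-ext _ V λ ℓ → case ℓ
    where
    case : ∀ ℓ → mem ℓ (grow V (all-lits n) U) ≡ mem ℓ V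
    case ℓ with mem ℓ V in e
    ... | true = g-hit V (all-lits n) U ℓ (∈-all-lits ℓ) e
    ... | false with mem ℓ (grow V (all-lits n) U) in e'
    ...   | true = sym (trans (sym e) (g-sub V (all-lits n) U h ℓ e'))
    ...   | false = refl

  w-grow : ∀ {n} (V : Clause n) xs U → width U ≤ width (grow V xs U)
  w-grow V xs U = width-mono U (grow V xs U) (λ ℓ → g-mono V xs U ℓ)

module Pieces where

  open Polynomials
  open Measures
  open ClauseAlgebra
  open import Data.Nat as ℕ using (ℕ; suc; _≤_; _+_; _*_; _∸_)
  import Data.Nat.Properties as NP
  open import Data.Nat.Solver using (module +-*-Solver)
  open import Data.Fin using (Fin)
  open import Data.Fin.Subset using (Subset; ∣_∣)
  open import Data.Vec as V using (lookup)
  open import Data.List using (List; []; _∷_; _++_; length; foldr; allFin)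
  open import Data.List.Relation.Unary.All using (All; []; _∷_)
  open import Data.List.Relation.Unary.Any using (here; there)
  open import Data.List.Membership.Propositional using (_∈_)
  open import Data.Product using (_,_)
  open import Data.Bool using (true; false; if_then_else_; _∨_)
  open import Data.Bool.Properties using (∨-zeroʳ)
  open import Data.Rational as Q using (ℚ; 0ℚ; 1ℚ)
  import Data.Rational.Properties as QP
  open import Data.Maybe using (Maybe; just; nothing)
  open import Relation.Binary.PropositionalEquality using (_≡_; refl; sym; trans; cong; cong₂; subst)
  open import Relation.Binary.Bundles using (Setoid)
  open import Relation.Nullary using (yes; no)
  open import Algebra.Bundles using (CommutativeRing)
  open import Algebra.Solver.Ring.AlmostCommutativeRing
  import Algebra.Solver.Ring as RS

  module PS (m : ℕ) where
    ACR = fromCommutativeRing (PolyRing m)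
    QR = CommutativeRing.rawRing QP.+-*-commutativeRing
    hom : QR -Raw-AlmostCommutative⟶ ACR
    hom = record { ⟦_⟧ = constP ; +-homo = const-+ ; *-homo = const-* ; -‿homo = λ _ _ → refl ; 0-homo = const-0 ; 1-homo = λ _ → refl }
    wdec : ∀ (a b : ℚ) → Maybe (constP {m} a ≈P constP b)
    wdec a b with a Q.≟ b
    ... | yes refl = just (λ _ → refl)
    ... | no _ = nothing
    open RS QR ACR hom wdec public

  ΣP : ∀ {m} → List (Poly m) → Poly m
  ΣP = foldr _+P_ 0P

  sumLx : ∀ {n m} → (Fin n → Poly m) → Subset n → List (Fin n) → Poly m
  sumLx g S xs = foldr (λ i acc → if lookup S i then g i +P acc else acc) [] xs

  sumL : ∀ {n m} → (Fin n → Poly m) → Subset n → Poly m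
  sumL {n} g S = sumLx g S (allFin n)

  cntL : ∀ {n} → Subset n → List (Fin n) → ℕ
  cntL S xs = foldr (λ i acc → if lookup S i then suc acc else acc) 0 xs

  cnt-FR : ∀ {k} (S : Subset k) → FR (λ _ → suc) S 0 ≡ ∣ S ∣
  cnt-FR V.[] = refl
  cnt-FR (true V.∷ S) = cong suc (cnt-FR S)
  cnt-FR (false V.∷ S) = cnt-FR S

  cnt-all : ∀ {n} (S : Subset n) → cntL S (allFin n) ≡ ∣ S ∣
  cnt-all S = trans (FR-allFin (λ _ → suc) S 0) (cnt-FR S)

  -- An encoding of the clauses of F into a Sherali–Adams-style system with
  -- axioms Ax, in m variables.  Both SA and SAR are instances.
  record Sys (n m : ℕ) (F : CNF n) (Ax : List (Poly m)) : Set where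
    field
      -- φ ℓ means "ℓ is false" and D C = ∏_{ℓ∈C} φ ℓ means "C is falsified".
      φ : Literal n → Poly m
      D : Clause n → Poly m
      D-∅ : D emptyClause ≈P constP 1ℚ
      D-ins : ∀ C ℓ → mem ℓ C ≡ false → D (C ∨ₗ ℓ) ≈P (φ ℓ *P D C)
      one∈ : constP 1ℚ ∈ Ax
      bφ : Literal n → Poly m
      bφ∈ : ∀ ℓ → bφ ℓ ∈ Ax
      bφ-eq : ∀ ℓ → bφ ℓ ≈P ((φ ℓ *P φ ℓ) -P φ ℓ)
      bφ-len : ∀ ℓ → length (bφ ℓ) ≤ 3
      bφ-deg : ∀ ℓ → DegLe (bφ ℓ) 2
      cax : Literal n → List (Poly m)
      cax∈ : ∀ ℓ → All (_∈ Ax) (cax ℓ)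
      cax-eq : ∀ ℓ → ΣP (cax ℓ) ≈P ((constP 1ℚ -P φ ℓ) -P φ (compl ℓ))
      cax-len : ∀ ℓ → All (λ p → length p ≤ 3) (cax ℓ)
      cax-deg : ∀ ℓ → All (λ p → DegLe p 1) (cax ℓ)
      cax-count : ∀ ℓ → length (cax ℓ) ≤ 1
      ncax : Literal n → List (Poly m)
      ncax∈ : ∀ ℓ → All (_∈ Ax) (ncax ℓ)
      ncax-eq : ∀ ℓ → ΣP (ncax ℓ) ≈P ((φ ℓ +P φ (compl ℓ)) -P constP 1ℚ)
      ncax-len : ∀ ℓ → All (λ p → length p ≤ 3) (ncax ℓ)
      ncax-deg : ∀ ℓ → All (λ p → DegLe p 1) (ncax ℓ)
      ncax-count : ∀ ℓ → length (ncax ℓ) ≤ 1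
      -- The encoding of a clause (P, N) is Σ_{i∈P} φ(x̄_i) + Σ_{j∈N} φ(x_j) - 1:
      -- a literal is true exactly when its complement is false.
      enc : Clause n → Poly m
      enc∈ : ∀ C → C ∈ F → enc C ∈ Ax
      enc-eq : ∀ P N → enc (P , N) ≈P ((sumL (λ i → φ (neg i)) P +P sumL (λ i → φ (pos i)) N) -P constP 1ℚ)
      enc-len : ∀ C → length (enc C) ≤ suc (2 * width C)
      enc-deg : ∀ C → DegLe (enc C) 1
      B : ℕ → ℕ
      B-mono : ∀ {a b} → a ≤ b → B a ≤ B b
      mk : (α : ℚ) → 0ℚ Q.≤ α → Clause n → (p : Poly m) → p ∈ Ax → Summand Ax
      mk-eq : ∀ α h W p h' → expand (mk α h W p h') ≈P (constP α *P (D W *P p))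
      mk-len : ∀ α h W p h' → length (expand (mk α h W p h')) ≤ B (width W) * length p
      mk-deg : ∀ α h W p h' r → DegLe p r → DegLe (expand (mk α h W p h')) (width W + r)

  infixl 6 _⊕_ _⊝_
  infixl 7 _⊗_

  -- Its constructors are injective, so setoid
  -- reasoning over _≈E_ can infer the intermediate polynomials, which it cannot
  -- do over _≈P_ (as _+P_, _*P_ are not injective).
  data PE (m : ℕ) : Set where
    ⟨_⟩ : Poly m → PE m
    _⊕_ _⊗_ _⊝_ : PE m → PE m → PE m

  ⟦_⟧ : ∀ {m} → PE m → Poly m
  ⟦ ⟨ p ⟩ ⟧ = p
  ⟦ a ⊕ b ⟧ = ⟦ a ⟧ +P ⟦ b ⟧
  ⟦ a ⊗ b ⟧ = ⟦ a ⟧ *P ⟦ b ⟧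
  ⟦ a ⊝ b ⟧ = ⟦ a ⟧ -P ⟦ b ⟧

  infix 4 _≈E_
  record _≈E_ {m : ℕ} (a b : PE m) : Set where
    constructor mkE
    field unE : ⟦ a ⟧ ≈P ⟦ b ⟧
  open _≈E_ public

  module _ {m : ℕ} where
    reflE : ∀ {a : PE m} → a ≈E a
    reflE = mkE (λ _ → refl)
    symE : ∀ {a b : PE m} → a ≈E b → b ≈E a
    symE (mkE h) = mkE (λ u → sym (h u))
    transE : ∀ {a b c : PE m} → a ≈E b → b ≈E c → a ≈E c
    transE (mkE h) (mkE g) = mkE (λ u → trans (h u) (g u))
    ⊕E : ∀ {a a' b b' : PE m} → a ≈E a' → b ≈E b' → (a ⊕ b) ≈E (a' ⊕ b')
    ⊕E {a} {a'} {b} {b'} (mkE h) (mkE g) = mkE (+P-cong {p = ⟦ a ⟧} {⟦ a' ⟧} {⟦ b ⟧} {⟦ b' ⟧} h g)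
    ⊗E : ∀ {a a' b b' : PE m} → a ≈E a' → b ≈E b' → (a ⊗ b) ≈E (a' ⊗ b')
    ⊗E {a} {a'} {b} {b'} (mkE h) (mkE g) = mkE (*P-cong {p = ⟦ a ⟧} {⟦ a' ⟧} {⟦ b ⟧} {⟦ b' ⟧} h g)
    ⊝E : ∀ {a a' b b' : PE m} → a ≈E a' → b ≈E b' → (a ⊝ b) ≈E (a' ⊝ b')
    ⊝E {a} {a'} {b} {b'} (mkE h) (mkE g) = mkE (+P-cong {p = ⟦ a ⟧} {⟦ a' ⟧} { -P ⟦ b ⟧} { -P ⟦ b' ⟧} h (-P-cong {p = ⟦ b ⟧} {⟦ b' ⟧} g))
    ≡E : ∀ {p q : Poly m} → p ≡ q → ⟨ p ⟩ ≈E ⟨ q ⟩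
    ≡E refl = reflE

    E-setoid : Setoid _ _
    E-setoid = record { Carrier = PE m ; _≈_ = _≈E_ ; isEquivalence = record { refl = reflE ; sym = symE ; trans = transE } }

  module _ {m : ℕ} {Ax : List (Poly m)} where
    total-++ : (d₁ d₂ : Derivation Ax) → total (d₁ ++ d₂) ≈P (total d₁ +P total d₂)
    total-++ [] d₂ u = refl
    total-++ (s ∷ d₁) d₂ u = trans (+R (expand s) (total (d₁ ++ d₂)) _ (total-++ d₁ d₂) u) (sym (+P-assoc (expand s) (total d₁) (total d₂) u))

    size-++ : (d₁ d₂ : Derivation Ax) → size (d₁ ++ d₂) ≡ size d₁ + size d₂
    size-++ [] d₂ = refl
    size-++ (s ∷ d₁) d₂ = trans (cong (nTerms (expand s) +_) (size-++ d₁ d₂)) (sym (NP.+-assoc (nTerms (expand s)) _ _))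

    rank-++ : ∀ r (d₁ d₂ : Derivation Ax) → rank d₁ ≤ r → rank d₂ ≤ r → rank (d₁ ++ d₂) ≤ r
    rank-++ r [] d₂ h₁ h₂ = h₂
    rank-++ r (s ∷ d₁) d₂ h₁ h₂ = NP.⊔-lub (NP.m⊔n≤o⇒m≤o _ _ h₁) (rank-++ r d₁ d₂ (NP.m⊔n≤o⇒n≤o _ _ h₁) h₂)

    record Piece (T : Poly m) (M r : ℕ) : Set where
      field
        der : Derivation Ax
        tot : total der ≈P T
        sz : size der ≤ M
        rk : rank der ≤ r
    open Piece public

    pEmpty : ∀ {r} → Piece 0P 0 r
    pEmpty = record { der = [] ; tot = λ u → refl ; sz = ℕ.z≤n ; rk = ℕ.z≤n }

    pApp : ∀ {T₁ T₂ M₁ M₂ r} → Piece T₁ M₁ r → Piece T₂ M₂ r → Piece (T₁ +P T₂) (M₁ + M₂) r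
    pApp {T₁} {T₂} π₁ π₂ = record
      { der = der π₁ ++ der π₂
      ; tot = λ u → trans (total-++ (der π₁) (der π₂) u) (+P-cong {p = total (der π₁)} {T₁} {total (der π₂)} {T₂} (tot π₁) (tot π₂) u)
      ; sz = subst (_≤ _) (sym (size-++ (der π₁) (der π₂))) (NP.+-mono-≤ (sz π₁) (sz π₂))
      ; rk = rank-++ _ (der π₁) (der π₂) (rk π₁) (rk π₂) }

    pConv : ∀ {T T' M M' r} → T ≈P T' → M ≤ M' → Piece T M r → Piece T' M' r
    pConv e le π = record { der = der π ; tot = λ u → trans (tot π u) (e u) ; sz = NP.≤-trans (sz π) le ; rk = rk π }

    pSingle : ∀ (s : Summand Ax) {T M r} → expand s ≈P T → length (expand s) ≤ M → DegLe (expand s) r → Piece T M r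
    pSingle s e l dg = record
      { der = s ∷ []
      ; tot = λ u → trans (+P-identityʳ (expand s) u) (e u)
      ; sz = NP.≤-trans (NP.≤-reflexive (NP.+-identityʳ _)) (NP.≤-trans (nTerms≤length (expand s)) l)
      ; rk = NP.⊔-lub (degree≤ (expand s) _ dg) ℕ.z≤n }

  module Build {n m : ℕ} {F : CNF n} {Ax : List (Poly m)} (Sy : Sys n m F Ax) (c : ℚ) (c0 : 0ℚ Q.≤ c) where
    open Sys Sy
    open PS m using (solve; _:+_; _:*_; _:-_; :-_; con; _:=_)

    cP : Poly m
    cP = constP c
    1P : Poly m
    1P = constP 1ℚ

    T : Clause n → Poly m → Poly m
    T W p = cP *P (D W *P p)

    Pc : Poly m → ℕ → ℕ → Set
    Pc = Piece {m} {Ax}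

    pOne : ∀ W p (h : p ∈ Ax) {r} dp → DegLe p dp → width W + dp ≤ r → Pc (T W p) (B (width W) * length p) r
    pOne W p h dp dg le = pSingle (mk c c0 W p h) (mk-eq c c0 W p h) (mk-len c c0 W p h) (DegLe-mono le (mk-deg c c0 W p h dp dg))

    pList : ∀ W (es : List (Poly m)) {r} → All (_∈ Ax) es → All (λ p → length p ≤ 3) es → All (λ p → DegLe p 1) es →
      width W + 1 ≤ r → Pc (T W (ΣP es)) (length es * (B (width W) * 3)) r
    pList W [] _ _ _ le = pConv (λ u → sym (z u)) ℕ.z≤n (pEmpty {Ax = Ax})
      where z : T W [] ≈P 0P
            z u = trans (*R cP (D W *P []) (D W *P constP 0ℚ) (*R (D W) [] (constP 0ℚ) (λ u → sym (const-0 {m} u))) u)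
                    (trans (solve 2 (λ x y → x :* (y :* con 0ℚ) := con 0ℚ) (λ u → refl) cP (D W) u) (const-0 u))
    pList W (e ∷ es) (h ∷ hs) (l ∷ ls) (g ∷ gs) le =
      pConv eq (NP.+-monoˡ-≤ _ (NP.*-monoʳ-≤ (B (width W)) l)) (pApp (pOne W e h 1 g le) (pList W es hs ls gs le))
      where
      eq : (T W e +P T W (ΣP es)) ≈P T W (ΣP (e ∷ es))
      eq = solve 4 (λ x y a b → x :* (y :* a) :+ x :* (y :* b) := x :* (y :* (a :+ b))) (λ u → refl) cP (D W) e (ΣP es)

    w+0 : ∀ a → a + 0 ≡ a
    w+0 a = NP.+-identityʳ a
    w+1 : ∀ a → a + 1 ≡ suc a
    w+1 a = NP.+-comm a 1
    *≤ : ∀ {a b c d} → a ≤ b → c ≤ d → a * c ≤ b * d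
    *≤ = NP.*-mono-≤
    +≤ : ∀ {a b c d} → a ≤ b → c ≤ d → a + c ≤ b + d
    +≤ = NP.+-mono-≤
    ≤r : ∀ {a} → a ≤ a
    ≤r = NP.≤-refl
    infixr 2 _≤∘_
    _≤∘_ : ∀ {a b c} → a ≤ b → b ≤ c → a ≤ c
    _≤∘_ = NP.≤-trans
    ≡≤ : ∀ {a b} → a ≡ b → a ≤ b
    ≡≤ = NP.≤-reflexive
    n≤7n : ∀ k a → k ≤ 7 → k * a ≤ 7 * a
    n≤7n k a h = *≤ h ≤r

    open import Relation.Binary.Reasoning.Setoid (E-setoid {m})
    module NS = +-*-Solver

    D-del : ∀ U ℓ → mem ℓ U ≡ true → ⟨ D U ⟩ ≈E (⟨ φ ℓ ⟩ ⊗ ⟨ D (del U ℓ) ⟩)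
    D-del U ℓ h = transE (≡E (cong D (sym (del-ins-C U ℓ h)))) (mkE (D-ins (del U ℓ) ℓ (mem-del-self U ℓ)))

    D-insE : ∀ C ℓ → mem ℓ C ≡ false → ⟨ D (C ∨ₗ ℓ) ⟩ ≈E (⟨ φ ℓ ⟩ ⊗ ⟨ D C ⟩)
    D-insE C ℓ h = mkE (D-ins C ℓ h)

    ⟪c⟫ : PE m
    ⟪c⟫ = ⟨ cP ⟩
    ⟪1⟫ : PE m
    ⟪1⟫ = ⟨ 1P ⟩
    ⟪D⟫ : Clause n → PE m
    ⟪D⟫ W = ⟨ D W ⟩
    ⟪φ⟫ : Literal n → PE m
    ⟪φ⟫ ℓ = ⟨ φ ℓ ⟩

    -- compl ℓ ∉ U: the sum of c·D(U ∨ compl ℓ)·1 and c·D U·(1 - φ ℓ - φ(compl ℓ)).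
    litStep-fresh : ∀ {r} U ℓ → mem ℓ U ≡ false → mem (compl ℓ) U ≡ false → suc (width U) ≤ r → Pc (cP *P (D U -P D (U ∨ₗ ℓ))) (7 * B r) r
    litStep-fresh {r} U ℓ nℓ eqc le = pConv (unE eq) szb (pApp (pOne (U ∨ₗ compl ℓ) 1P one∈ 0 (DegLe-const 1ℚ) le₁) (pList U (cax ℓ) (cax∈ ℓ) (cax-len ℓ) (cax-deg ℓ) le₂))
      where
      cℓ = compl ℓ
      le₁ : width (U ∨ₗ cℓ) + 0 ≤ r
      le₁ = subst (_≤ r) (sym (trans (w+0 _) (width-ins U cℓ eqc))) le
      le₂ : width U + 1 ≤ r
      le₂ = subst (_≤ r) (sym (w+1 _)) le
      X = ⟨ ΣP (cax ℓ) ⟩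
      eq : (⟪c⟫ ⊗ (⟪D⟫ (U ∨ₗ cℓ) ⊗ ⟪1⟫)) ⊕ (⟪c⟫ ⊗ (⟪D⟫ U ⊗ X)) ≈E ⟪c⟫ ⊗ (⟪D⟫ U ⊝ ⟪D⟫ (U ∨ₗ ℓ))
      eq = begin
          (⟪c⟫ ⊗ (⟪D⟫ (U ∨ₗ cℓ) ⊗ ⟪1⟫)) ⊕ (⟪c⟫ ⊗ (⟪D⟫ U ⊗ X))
        ≈⟨ ⊕E (⊗E reflE (⊗E (D-insE U cℓ eqc) reflE)) (⊗E reflE (⊗E reflE (mkE (cax-eq ℓ)))) ⟩
          (⟪c⟫ ⊗ ((⟪φ⟫ cℓ ⊗ ⟪D⟫ U) ⊗ ⟪1⟫)) ⊕ (⟪c⟫ ⊗ (⟪D⟫ U ⊗ ((⟪1⟫ ⊝ ⟪φ⟫ ℓ) ⊝ ⟪φ⟫ cℓ)))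
        ≈⟨ mkE (solve 4 (λ x d a b → x :* ((b :* d) :* con 1ℚ) :+ x :* (d :* ((con 1ℚ :- a) :- b)) := x :* (d :- a :* d)) (λ u → refl) cP (D U) (φ ℓ) (φ cℓ)) ⟩
          ⟪c⟫ ⊗ (⟪D⟫ U ⊝ (⟪φ⟫ ℓ ⊗ ⟪D⟫ U))
        ≈⟨ ⊗E reflE (⊝E reflE (symE (D-insE U ℓ nℓ))) ⟩
          ⟪c⟫ ⊗ (⟪D⟫ U ⊝ ⟪D⟫ (U ∨ₗ ℓ)) ∎
      Br≥ : B (width U) ≤ B r
      Br≥ = B-mono (NP.≤-trans (NP.n≤1+n _) le)
      szb : B (width (U ∨ₗ cℓ)) * 1 + length (cax ℓ) * (B (width U) * 3) ≤ 7 * B r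
      szb = +≤ (*≤ (B-mono (subst (_≤ r) (sym (width-ins U cℓ eqc)) le)) (≤r {1})) (*≤ (cax-count ℓ) (*≤ Br≥ (≤r {3})))
            ≤∘ (≡≤ (NS.solve 1 (λ b → b NS.:* NS.con 1 NS.:+ NS.con 1 NS.:* (b NS.:* NS.con 3) NS.:= NS.con 4 NS.:* b) refl (B r))
            ≤∘ n≤7n 4 (B r) (ℕ.s≤s (ℕ.s≤s (ℕ.s≤s (ℕ.s≤s ℕ.z≤n)))))
    -- compl ℓ ∈ U: with R = D(U - compl ℓ), the sum of c·D U·1, c·R·(φ(compl ℓ)² - φ(compl ℓ))
    -- and c·D U·(1 - φ ℓ - φ(compl ℓ)).
    litStep-clash : ∀ {r} U ℓ → mem ℓ U ≡ false → mem (compl ℓ) U ≡ true → suc (width U) ≤ r → Pc (cP *P (D U -P D (U ∨ₗ ℓ))) (7 * B r) r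
    litStep-clash {r} U ℓ nℓ eqc le = pConv (unE eq) szb (pApp (pApp (pOne U 1P one∈ 0 (DegLe-const 1ℚ) le₁) (pOne (del U cℓ) (bφ cℓ) (bφ∈ cℓ) 2 (bφ-deg cℓ) le₃))
                                            (pList U (cax ℓ) (cax∈ ℓ) (cax-len ℓ) (cax-deg ℓ) le₂))
      where
      cℓ = compl ℓ
      R = D (del U cℓ)
      wd : suc (width (del U cℓ)) ≡ width U
      wd = width-del U cℓ eqc
      le₁ : width U + 0 ≤ r
      le₁ = subst (_≤ r) (sym (w+0 _)) (NP.≤-trans (NP.n≤1+n _) le)
      le₂ : width U + 1 ≤ r
      le₂ = subst (_≤ r) (sym (w+1 _)) le
      le₃ : width (del U cℓ) + 2 ≤ r
      le₃ = subst (_≤ r) (sym (trans (NP.+-comm _ 2) (cong suc wd))) le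
      X = ⟨ ΣP (cax ℓ) ⟩
      eq : ((⟪c⟫ ⊗ (⟪D⟫ U ⊗ ⟪1⟫)) ⊕ (⟪c⟫ ⊗ (⟨ R ⟩ ⊗ ⟨ bφ cℓ ⟩))) ⊕ (⟪c⟫ ⊗ (⟪D⟫ U ⊗ X)) ≈E ⟪c⟫ ⊗ (⟪D⟫ U ⊝ ⟪D⟫ (U ∨ₗ ℓ))
      eq = begin
          ((⟪c⟫ ⊗ (⟪D⟫ U ⊗ ⟪1⟫)) ⊕ (⟪c⟫ ⊗ (⟨ R ⟩ ⊗ ⟨ bφ cℓ ⟩))) ⊕ (⟪c⟫ ⊗ (⟪D⟫ U ⊗ X))
        ≈⟨ ⊕E (⊕E (⊗E reflE (⊗E (D-del U cℓ eqc) reflE)) (⊗E reflE (⊗E reflE (mkE (bφ-eq cℓ))))) (⊗E reflE (⊗E (D-del U cℓ eqc) (mkE (cax-eq ℓ)))) ⟩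
          ((⟪c⟫ ⊗ ((⟪φ⟫ cℓ ⊗ ⟨ R ⟩) ⊗ ⟪1⟫)) ⊕ (⟪c⟫ ⊗ (⟨ R ⟩ ⊗ ((⟪φ⟫ cℓ ⊗ ⟪φ⟫ cℓ) ⊝ ⟪φ⟫ cℓ)))) ⊕ (⟪c⟫ ⊗ ((⟪φ⟫ cℓ ⊗ ⟨ R ⟩) ⊗ ((⟪1⟫ ⊝ ⟪φ⟫ ℓ) ⊝ ⟪φ⟫ cℓ)))
        ≈⟨ mkE (solve 4 (λ x d a b → (x :* ((b :* d) :* con 1ℚ) :+ x :* (d :* ((b :* b) :- b))) :+ x :* ((b :* d) :* ((con 1ℚ :- a) :- b)) := x :* ((b :* d) :- a :* (b :* d))) (λ u → refl) cP R (φ ℓ) (φ cℓ)) ⟩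
          ⟪c⟫ ⊗ ((⟪φ⟫ cℓ ⊗ ⟨ R ⟩) ⊝ (⟪φ⟫ ℓ ⊗ (⟪φ⟫ cℓ ⊗ ⟨ R ⟩)))
        ≈⟨ ⊗E reflE (⊝E (symE (D-del U cℓ eqc)) (transE (⊗E reflE (symE (D-del U cℓ eqc))) (symE (D-insE U ℓ nℓ)))) ⟩
          ⟪c⟫ ⊗ (⟪D⟫ U ⊝ ⟪D⟫ (U ∨ₗ ℓ)) ∎
      Br≥ : B (width U) ≤ B r
      Br≥ = B-mono (NP.≤-trans (NP.n≤1+n _) le)
      Bd≥ : B (width (del U cℓ)) ≤ B r
      Bd≥ = B-mono (NP.≤-trans (NP.≤-trans (NP.n≤1+n _) (NP.≤-reflexive wd)) (NP.≤-trans (NP.n≤1+n _) le))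
      szb : (B (width U) * 1 + B (width (del U cℓ)) * length (bφ cℓ)) + length (cax ℓ) * (B (width U) * 3) ≤ 7 * B r
      szb = +≤ (+≤ (*≤ Br≥ (≤r {1})) (*≤ Bd≥ (bφ-len cℓ))) (*≤ (cax-count ℓ) (*≤ Br≥ (≤r {3})))
            ≤∘ ≡≤ (NS.solve 1 (λ b → (b NS.:* NS.con 1 NS.:+ b NS.:* NS.con 3) NS.:+ NS.con 1 NS.:* (b NS.:* NS.con 3) NS.:= NS.con 7 NS.:* b) refl (B r))

    -- Adding one absent literal ℓ to U: c·(D U - D (U ∨ ℓ)) = c·D U·(1 - φ ℓ) is
    -- derivable within 7·B(r) terms and rank r ≥ |U| + 1.
    litStep : ∀ {r} U ℓ → mem ℓ U ≡ false → suc (width U) ≤ r → Pc (cP *P (D U -P D (U ∨ₗ ℓ))) (7 * B r) r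
    litStep U ℓ nℓ le with mem (compl ℓ) U in eqc
    ... | false = litStep-fresh U ℓ nℓ eqc le
    ... | true = litStep-clash U ℓ nℓ eqc le

    zeroPiece : ∀ {M r} X → Pc (cP *P (X -P X)) M r
    zeroPiece X = pConv (unE eq) ℕ.z≤n (pEmpty {Ax = Ax})
      where
      eq : ⟨ 0P ⟩ ≈E ⟪c⟫ ⊗ (⟨ X ⟩ ⊝ ⟨ X ⟩)
      eq = transE {b = ⟨ constP 0ℚ ⟩} (mkE (λ u → sym (const-0 {m} u))) (mkE (solve 2 (λ x d → con 0ℚ := x :* (d :- d)) (λ u → refl) cP X))

    -- Monotonicity: for U ⊆ V, c·(D U - D V) is derivable by telescoping over the
    -- literals added one at a time with litStep.
    monoL : ∀ {r} V → width V ≤ r → ∀ xs U → U ⊑ V →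
      Pc (cP *P (D U -P D (grow V xs U))) (7 * B r * (width (grow V xs U) ∸ width U)) r
    monoL V wV [] U h = zeroPiece (D U)
    monoL {r} V wV (ℓ ∷ xs) U h with mem ℓ V in e
    ... | false = monoL V wV xs U h
    ... | true with mem ℓ U in e'
    ...   | true rewrite ins-mem-C U ℓ e' = monoL V wV xs U h
    ...   | false = pConv (unE eq) szb (pApp (litStep U ℓ e' le) (monoL V wV xs (U ∨ₗ ℓ) (⊑-ins U V ℓ h e)))
      where
      U' = U ∨ₗ ℓ
      G = grow V xs U'
      wU' : width U' ≡ suc (width U)
      wU' = width-ins U ℓ e'
      le : suc (width U) ≤ r
      le = NP.≤-trans (NP.≤-reflexive (sym wU')) (NP.≤-trans (width-mono U' V (⊑-ins U V ℓ h e)) wV)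
      eq : (⟪c⟫ ⊗ (⟪D⟫ U ⊝ ⟪D⟫ U')) ⊕ (⟪c⟫ ⊗ (⟪D⟫ U' ⊝ ⟪D⟫ G)) ≈E ⟪c⟫ ⊗ (⟪D⟫ U ⊝ ⟪D⟫ G)
      eq = mkE (solve 4 (λ x a b g → x :* (a :- b) :+ x :* (b :- g) := x :* (a :- g)) (λ u → refl) cP (D U) (D U') (D G))
      K = 7 * B r
      wG : suc (width U) ≤ width G
      wG = NP.≤-trans (NP.≤-reflexive (sym wU')) (w-grow V xs U')
      szb : K + K * (width G ∸ width U') ≤ K * (width G ∸ width U)
      szb = NP.≤-reflexive (trans (cong (λ z → K + K * (width G ∸ z)) wU')
              (trans (sym (NP.*-suc K (width G ∸ suc (width U)))) (cong (K *_) (sym (NP.+-∸-assoc 1 wG)))))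

    mono : ∀ {r} U V → U ⊑ V → width V ≤ r → Pc (cP *P (D U -P D V)) (7 * B r * width V) r
    mono {r} U V h wV = subst (λ Z → Pc (cP *P (D U -P D Z)) (7 * B r * width V) r) (g-final V U h)
      (pConv (λ u → refl) (NP.*-monoʳ-≤ (7 * B r) (NP.≤-trans (NP.m∸n≤m _ (width U)) (NP.≤-reflexive (cong width (g-final V U h))))) (monoL V wV (all-lits n) U h))

    module AxiomCorrections (C : Clause n) {w : ℕ} (wC : width C ≤ w) where
      K : ℕ
      K = 6 * B (suc w)

      -- For ℓ ∈ C, with R = D(C - ℓ) so that D C = φ ℓ · R:
      -- -D C·φ(compl ℓ) = D C·(1 - φ ℓ - φ(compl ℓ)) + R·(φ ℓ² - φ ℓ).
      corr : ∀ ℓ → mem ℓ C ≡ true → Pc (cP *P (-P (D C *P φ (compl ℓ)))) K (suc w)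
      corr ℓ h = pConv (unE eq) szb (pApp (pList C (cax ℓ) (cax∈ ℓ) (cax-len ℓ) (cax-deg ℓ) le₁) (pOne (del C ℓ) (bφ ℓ) (bφ∈ ℓ) 2 (bφ-deg ℓ) le₂))
        where
        R = D (del C ℓ)
        wd : suc (width (del C ℓ)) ≡ width C
        wd = width-del C ℓ h
        le₁ : width C + 1 ≤ suc w
        le₁ = subst (_≤ suc w) (sym (w+1 _)) (ℕ.s≤s wC)
        le₂ : width (del C ℓ) + 2 ≤ suc w
        le₂ = subst (_≤ suc w) (sym (trans (NP.+-comm _ 2) (cong suc wd))) (ℕ.s≤s wC)
        eq : (⟪c⟫ ⊗ (⟪D⟫ C ⊗ ⟨ ΣP (cax ℓ) ⟩)) ⊕ (⟪c⟫ ⊗ (⟨ R ⟩ ⊗ ⟨ bφ ℓ ⟩)) ≈E ⟪c⟫ ⊗ (⟨ 0P ⟩ ⊝ (⟪D⟫ C ⊗ ⟪φ⟫ (compl ℓ)))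
        eq = begin
            (⟪c⟫ ⊗ (⟪D⟫ C ⊗ ⟨ ΣP (cax ℓ) ⟩)) ⊕ (⟪c⟫ ⊗ (⟨ R ⟩ ⊗ ⟨ bφ ℓ ⟩))
          ≈⟨ ⊕E (⊗E reflE (⊗E (D-del C ℓ h) (mkE (cax-eq ℓ)))) (⊗E reflE (⊗E reflE (mkE (bφ-eq ℓ)))) ⟩
            (⟪c⟫ ⊗ ((⟪φ⟫ ℓ ⊗ ⟨ R ⟩) ⊗ ((⟪1⟫ ⊝ ⟪φ⟫ ℓ) ⊝ ⟪φ⟫ (compl ℓ)))) ⊕ (⟪c⟫ ⊗ (⟨ R ⟩ ⊗ ((⟪φ⟫ ℓ ⊗ ⟪φ⟫ ℓ) ⊝ ⟪φ⟫ ℓ)))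
          ≈⟨ mkE (solve 4 (λ x d a b → x :* ((a :* d) :* ((con 1ℚ :- a) :- b)) :+ x :* (d :* ((a :* a) :- a)) := x :* (con 0ℚ :- ((a :* d) :* b))) (λ u → refl) cP R (φ ℓ) (φ (compl ℓ))) ⟩
            ⟪c⟫ ⊗ (⟨ constP 0ℚ ⟩ ⊝ ((⟪φ⟫ ℓ ⊗ ⟨ R ⟩) ⊗ ⟪φ⟫ (compl ℓ)))
          ≈⟨ ⊗E reflE (⊝E (mkE (const-0 {m})) (⊗E (symE (D-del C ℓ h)) reflE)) ⟩
            ⟪c⟫ ⊗ (⟨ 0P ⟩ ⊝ (⟪D⟫ C ⊗ ⟪φ⟫ (compl ℓ))) ∎
        szb : length (cax ℓ) * (B (width C) * 3) + B (width (del C ℓ)) * length (bφ ℓ) ≤ K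
        szb = +≤ (*≤ (cax-count ℓ) (*≤ (B-mono (NP.≤-trans wC (NP.n≤1+n _))) (≤r {3})))
                 (*≤ (B-mono (NP.≤-trans (NP.n≤1+n _) (NP.≤-trans (NP.≤-reflexive wd) (NP.≤-trans wC (NP.n≤1+n _))))) (bφ-len ℓ))
              ≤∘ ≡≤ (NS.solve 1 (λ b → NS.con 1 NS.:* (b NS.:* NS.con 3) NS.:+ b NS.:* NS.con 3 NS.:= NS.con 6 NS.:* b) refl (B (suc w)))

      corrs : (S : Subset n) (lit : Fin n → Literal n) → (∀ i → lookup S i ≡ true → mem (lit i) C ≡ true) → ∀ xs →
        Pc (cP *P (0P -P (D C *P sumLx (λ i → φ (compl (lit i))) S xs))) (K * cntL S xs) (suc w)
      corrs S lit h [] = pConv (unE eq) ℕ.z≤n (pEmpty {Ax = Ax})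
        where
        eq : ⟨ 0P ⟩ ≈E ⟪c⟫ ⊗ (⟨ 0P ⟩ ⊝ (⟪D⟫ C ⊗ ⟨ 0P ⟩))
        eq = transE {b = ⟨ constP 0ℚ ⟩} (mkE (λ u → sym (const-0 {m} u)))
               (transE {b = ⟪c⟫ ⊗ (⟨ constP 0ℚ ⟩ ⊝ (⟪D⟫ C ⊗ ⟨ constP 0ℚ ⟩))} (mkE (solve 2 (λ x d → con 0ℚ := x :* (con 0ℚ :- (d :* con 0ℚ))) (λ u → refl) cP (D C)))
                       (⊗E reflE (⊝E (mkE (const-0 {m})) (⊗E reflE (mkE (const-0 {m}))))))
      corrs S lit h (i ∷ xs) with lookup S i in e
      ... | false = corrs S lit h xs
      ... | true = pConv (unE eq) (≡≤ (sym (NP.*-suc K (cntL S xs)))) (pApp (corr (lit i) (h i e)) (corrs S lit h xs))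
        where
        Y = ⟨ sumLx (λ i → φ (compl (lit i))) S xs ⟩
        eq : (⟪c⟫ ⊗ (⟨ 0P ⟩ ⊝ (⟪D⟫ C ⊗ ⟪φ⟫ (compl (lit i))))) ⊕ (⟪c⟫ ⊗ (⟨ 0P ⟩ ⊝ (⟪D⟫ C ⊗ Y))) ≈E ⟪c⟫ ⊗ (⟨ 0P ⟩ ⊝ (⟪D⟫ C ⊗ (⟪φ⟫ (compl (lit i)) ⊕ Y)))
        eq = begin
            (⟪c⟫ ⊗ (⟨ 0P ⟩ ⊝ (⟪D⟫ C ⊗ ⟪φ⟫ (compl (lit i))))) ⊕ (⟪c⟫ ⊗ (⟨ 0P ⟩ ⊝ (⟪D⟫ C ⊗ Y)))
          ≈⟨ ⊕E (⊗E reflE (⊝E z reflE)) (⊗E reflE (⊝E z reflE)) ⟩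
            (⟪c⟫ ⊗ (⟨ constP 0ℚ ⟩ ⊝ (⟪D⟫ C ⊗ ⟪φ⟫ (compl (lit i))))) ⊕ (⟪c⟫ ⊗ (⟨ constP 0ℚ ⟩ ⊝ (⟪D⟫ C ⊗ Y)))
          ≈⟨ mkE (solve 4 (λ x d a y → x :* (con 0ℚ :- (d :* a)) :+ x :* (con 0ℚ :- (d :* y)) := x :* (con 0ℚ :- (d :* (a :+ y)))) (λ u → refl) cP (D C) (φ (compl (lit i))) (sumLx (λ i → φ (compl (lit i))) S xs)) ⟩
            ⟪c⟫ ⊗ (⟨ constP 0ℚ ⟩ ⊝ (⟪D⟫ C ⊗ (⟪φ⟫ (compl (lit i)) ⊕ Y)))
          ≈⟨ ⊗E reflE (⊝E (symE z) reflE) ⟩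
            ⟪c⟫ ⊗ (⟨ 0P ⟩ ⊝ (⟪D⟫ C ⊗ (⟪φ⟫ (compl (lit i)) ⊕ Y))) ∎
          where z : ⟨ 0P ⟩ ≈E ⟨ constP 0ℚ ⟩
                z = mkE (λ u → sym (const-0 {m} u))

    -- For an axiom C = (P, N): c·(0 - D C) is c·D C·enc(C) minus the corrections
    -- c·D C·φ(compl ℓ) for the literals ℓ of C.
    axPiece : ∀ P N {w} → width (P , N) ≤ w → (P , N) ∈ F →
      Pc (cP *P (0P -P D (P , N))) (B w * suc (2 * w) + 6 * B (suc w) * w) (suc w)
    axPiece P N {w} wC h = pConv (unE eq) szb (pApp (pOne C (enc C) (enc∈ C h) 1 (enc-deg C) le) (pApp (corrs P pos (λ i e → e) (allFin n)) (corrs N neg (λ i e → e) (allFin n))))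
      where
      C = (P , N)
      open AxiomCorrections C wC
      le : width C + 1 ≤ suc w
      le = subst (_≤ suc w) (sym (w+1 _)) (ℕ.s≤s wC)
      SP = sumL (λ i → φ (neg i)) P
      SN = sumL (λ i → φ (pos i)) N
      z : ⟨ 0P ⟩ ≈E ⟨ constP 0ℚ ⟩
      z = mkE (λ u → sym (const-0 {m} u))
      eq : (⟪c⟫ ⊗ (⟪D⟫ C ⊗ ⟨ enc C ⟩)) ⊕ ((⟪c⟫ ⊗ (⟨ 0P ⟩ ⊝ (⟪D⟫ C ⊗ ⟨ SP ⟩))) ⊕ (⟪c⟫ ⊗ (⟨ 0P ⟩ ⊝ (⟪D⟫ C ⊗ ⟨ SN ⟩)))) ≈E ⟪c⟫ ⊗ (⟨ 0P ⟩ ⊝ ⟪D⟫ C)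
      eq = begin
          (⟪c⟫ ⊗ (⟪D⟫ C ⊗ ⟨ enc C ⟩)) ⊕ ((⟪c⟫ ⊗ (⟨ 0P ⟩ ⊝ (⟪D⟫ C ⊗ ⟨ SP ⟩))) ⊕ (⟪c⟫ ⊗ (⟨ 0P ⟩ ⊝ (⟪D⟫ C ⊗ ⟨ SN ⟩))))
        ≈⟨ ⊕E (⊗E reflE (⊗E reflE (mkE (enc-eq P N)))) (⊕E (⊗E reflE (⊝E z reflE)) (⊗E reflE (⊝E z reflE))) ⟩
          (⟪c⟫ ⊗ (⟪D⟫ C ⊗ ((⟨ SP ⟩ ⊕ ⟨ SN ⟩) ⊝ ⟪1⟫))) ⊕ ((⟪c⟫ ⊗ (⟨ constP 0ℚ ⟩ ⊝ (⟪D⟫ C ⊗ ⟨ SP ⟩))) ⊕ (⟪c⟫ ⊗ (⟨ constP 0ℚ ⟩ ⊝ (⟪D⟫ C ⊗ ⟨ SN ⟩))))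
        ≈⟨ mkE (solve 4 (λ x d a b → x :* (d :* ((a :+ b) :- con 1ℚ)) :+ (x :* (con 0ℚ :- (d :* a)) :+ x :* (con 0ℚ :- (d :* b))) := x :* (con 0ℚ :- d)) (λ u → refl) cP (D C) SP SN) ⟩
          ⟪c⟫ ⊗ (⟨ constP 0ℚ ⟩ ⊝ ⟪D⟫ C)
        ≈⟨ ⊗E reflE (⊝E (symE z) reflE) ⟩
          ⟪c⟫ ⊗ (⟨ 0P ⟩ ⊝ ⟪D⟫ C) ∎
      szb : B (width C) * length (enc C) + (K * cntL P (allFin n) + K * cntL N (allFin n)) ≤ B w * suc (2 * w) + 6 * B (suc w) * w
      szb = +≤ (*≤ (B-mono wC) (enc-len C ≤∘ ℕ.s≤s (*≤ (≤r {2}) wC)))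
               (≡≤ (trans (cong₂ (λ a b → K * a + K * b) (cnt-all P) (cnt-all N)) (sym (NP.*-distribˡ-+ K ∣ P ∣ ∣ N ∣))) ≤∘ *≤ (≤r {K}) wC)

    -- If x or x̄ is
    -- in K it is c·D(K ∨ x̄)·1 resp. c·D(K ∨ x)·1, otherwise it is c·D K times the
    -- complementarity axiom φ x + φ x̄ - 1.
    leftover : ∀ (K : Clause n) x {w} → width K ≤ w → Pc (cP *P ((D (K ∨ₗ x) +P D (K ∨ₗ compl x)) -P D K)) (3 * B (suc w)) (suc w)
    leftover K x {w} wK with mem x K in e₁ | mem (compl x) K in e₂
    ... | true | _ = pConv (unE eq) szb (pOne (K ∨ₗ compl x) 1P one∈ 0 (DegLe-const 1ℚ) le)
      where
      le : width (K ∨ₗ compl x) + 0 ≤ suc w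
      le = subst (_≤ suc w) (sym (w+0 _)) (width-ins≤ K (compl x) ≤∘ ℕ.s≤s wK)
      eq : ⟪c⟫ ⊗ (⟪D⟫ (K ∨ₗ compl x) ⊗ ⟪1⟫) ≈E ⟪c⟫ ⊗ ((⟪D⟫ (K ∨ₗ x) ⊕ ⟪D⟫ (K ∨ₗ compl x)) ⊝ ⟪D⟫ K)
      eq = transE (mkE (solve 3 (λ c a b → c :* (b :* con 1ℚ) := c :* ((a :+ b) :- a)) (λ u → refl) cP (D K) (D (K ∨ₗ compl x))))
                  (⊗E reflE (⊝E (⊕E (≡E (cong D (sym (ins-mem-C K x e₁)))) reflE) reflE))
      szb : B (width (K ∨ₗ compl x)) * 1 ≤ 3 * B (suc w)
      szb = *≤ (B-mono (width-ins≤ K (compl x) ≤∘ ℕ.s≤s wK)) (≤r {1}) ≤∘ ≡≤ (NP.*-comm (B (suc w)) 1) ≤∘ *≤ {1} {3} (ℕ.s≤s ℕ.z≤n) (≤r {B (suc w)})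
    ... | false | true = pConv (unE eq) szb (pOne (K ∨ₗ x) 1P one∈ 0 (DegLe-const 1ℚ) le)
      where
      le : width (K ∨ₗ x) + 0 ≤ suc w
      le = subst (_≤ suc w) (sym (w+0 _)) (width-ins≤ K x ≤∘ ℕ.s≤s wK)
      eq : ⟪c⟫ ⊗ (⟪D⟫ (K ∨ₗ x) ⊗ ⟪1⟫) ≈E ⟪c⟫ ⊗ ((⟪D⟫ (K ∨ₗ x) ⊕ ⟪D⟫ (K ∨ₗ compl x)) ⊝ ⟪D⟫ K)
      eq = transE (mkE (solve 3 (λ c a b → c :* (b :* con 1ℚ) := c :* ((b :+ a) :- a)) (λ u → refl) cP (D K) (D (K ∨ₗ x))))
                  (⊗E reflE (⊝E (⊕E reflE (≡E (cong D (sym (ins-mem-C K (compl x) e₂))))) reflE))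
      szb : B (width (K ∨ₗ x)) * 1 ≤ 3 * B (suc w)
      szb = *≤ (B-mono (width-ins≤ K x ≤∘ ℕ.s≤s wK)) (≤r {1}) ≤∘ ≡≤ (NP.*-comm (B (suc w)) 1) ≤∘ *≤ {1} {3} (ℕ.s≤s ℕ.z≤n) (≤r {B (suc w)})
    ... | false | false = pConv (unE eq) szb (pList K (ncax x) (ncax∈ x) (ncax-len x) (ncax-deg x) le)
      where
      le : width K + 1 ≤ suc w
      le = subst (_≤ suc w) (sym (w+1 _)) (ℕ.s≤s wK)
      eq : ⟪c⟫ ⊗ (⟪D⟫ K ⊗ ⟨ ΣP (ncax x) ⟩) ≈E ⟪c⟫ ⊗ ((⟪D⟫ (K ∨ₗ x) ⊕ ⟪D⟫ (K ∨ₗ compl x)) ⊝ ⟪D⟫ K)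
      eq = begin
          ⟪c⟫ ⊗ (⟪D⟫ K ⊗ ⟨ ΣP (ncax x) ⟩)
        ≈⟨ ⊗E reflE (⊗E reflE (mkE (ncax-eq x))) ⟩
          ⟪c⟫ ⊗ (⟪D⟫ K ⊗ ((⟪φ⟫ x ⊕ ⟪φ⟫ (compl x)) ⊝ ⟪1⟫))
        ≈⟨ mkE (solve 4 (λ c d a b → c :* (d :* ((a :+ b) :- con 1ℚ)) := c :* (((a :* d) :+ (b :* d)) :- d)) (λ u → refl) cP (D K) (φ x) (φ (compl x))) ⟩
          ⟪c⟫ ⊗ (((⟪φ⟫ x ⊗ ⟪D⟫ K) ⊕ (⟪φ⟫ (compl x) ⊗ ⟪D⟫ K)) ⊝ ⟪D⟫ K)
        ≈⟨ ⊗E reflE (⊝E (⊕E (symE (D-insE K x e₁)) (symE (D-insE K (compl x) e₂))) reflE) ⟩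
          ⟪c⟫ ⊗ ((⟪D⟫ (K ∨ₗ x) ⊕ ⟪D⟫ (K ∨ₗ compl x)) ⊝ ⟪D⟫ K) ∎
      szb : length (ncax x) * (B (width K) * 3) ≤ 3 * B (suc w)
      szb = *≤ (ncax-count x) (*≤ (B-mono (wK ≤∘ NP.n≤1+n _)) (≤r {3})) ≤∘ ≡≤ (trans (NP.*-identityˡ _) (NP.*-comm (B (suc w)) 3))

    Mstep : ℕ → ℕ
    Mstep w = 17 * (B (suc w) * suc w)

    -- Resolution: c·(D(A ∨ x) + D(B ∨ x̄) - D(A ∨ B)) by monotonicity into
    -- (A∨B) ∨ x, (A∨B) ∨ x̄ and the leftover.
    resPiece : ∀ (A B' : Clause n) x {w} → width (A ∨ₗ x) ≤ w → width (B' ∨ₗ compl x) ≤ w → width (A ∨c B') ≤ w →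
      Pc (cP *P ((D (A ∨ₗ x) +P D (B' ∨ₗ compl x)) -P D (A ∨c B'))) (Mstep w) (suc w)
    resPiece A B' x {w} wi wj wk = pConv (unE eq) szb (pApp (pApp (mono (A ∨ₗ x) (K ∨ₗ x) subi wKx) (mono (B' ∨ₗ compl x) (K ∨ₗ compl x) subj wKcx)) (leftover K x wk))
      where
      K = A ∨c B'
      wKx : width (K ∨ₗ x) ≤ suc w
      wKx = width-ins≤ K x ≤∘ ℕ.s≤s wk
      wKcx : width (K ∨ₗ compl x) ≤ suc w
      wKcx = width-ins≤ K (compl x) ≤∘ ℕ.s≤s wk
      subi : (A ∨ₗ x) ⊑ (K ∨ₗ x)
      subi ℓ h with ℓ ≟L x
      ... | yes refl = mem-ins-self K ℓ
      ... | no ne = mem-ins K x ℓ (trans (mem-∨c A B' ℓ) (cong (_∨ mem ℓ B') (trans (sym (mem-ins-other A x ℓ ne)) h)))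
      subj : (B' ∨ₗ compl x) ⊑ (K ∨ₗ compl x)
      subj ℓ h with ℓ ≟L compl x
      ... | yes refl = mem-ins-self K ℓ
      ... | no ne = mem-ins K (compl x) ℓ (trans (mem-∨c A B' ℓ) (trans (cong (mem ℓ A ∨_) (trans (sym (mem-ins-other B' (compl x) ℓ ne)) h)) (∨-zeroʳ (mem ℓ A))))
      eq : ((⟪c⟫ ⊗ (⟪D⟫ (A ∨ₗ x) ⊝ ⟪D⟫ (K ∨ₗ x))) ⊕ (⟪c⟫ ⊗ (⟪D⟫ (B' ∨ₗ compl x) ⊝ ⟪D⟫ (K ∨ₗ compl x)))) ⊕ (⟪c⟫ ⊗ ((⟪D⟫ (K ∨ₗ x) ⊕ ⟪D⟫ (K ∨ₗ compl x)) ⊝ ⟪D⟫ K))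
           ≈E ⟪c⟫ ⊗ ((⟪D⟫ (A ∨ₗ x) ⊕ ⟪D⟫ (B' ∨ₗ compl x)) ⊝ ⟪D⟫ K)
      eq = mkE (solve 6 (λ c a b p q k → (c :* (a :- p) :+ c :* (b :- q)) :+ c :* ((p :+ q) :- k) := c :* ((a :+ b) :- k)) (λ u → refl)
                 cP (D (A ∨ₗ x)) (D (B' ∨ₗ compl x)) (D (K ∨ₗ x)) (D (K ∨ₗ compl x)) (D K))
      b = B (suc w)
      szb : (7 * b * width (K ∨ₗ x) + 7 * b * width (K ∨ₗ compl x)) + 3 * B (suc w) ≤ Mstep w
      szb = +≤ (+≤ (*≤ (≤r {7 * b}) wKx) (*≤ (≤r {7 * b}) wKcx)) (≤r {3 * b})
          ≤∘ (≡≤ (NS.solve 2 (λ b v → (NS.con 7 NS.:* b NS.:* v NS.:+ NS.con 7 NS.:* b NS.:* v) NS.:+ NS.con 3 NS.:* b NS.:= NS.con 14 NS.:* (b NS.:* v) NS.:+ NS.con 3 NS.:* b) refl b (suc w))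
          ≤∘ (+≤ (≤r {14 * (b * suc w)}) (*≤ (≤r {3}) (NP.m≤m*n b (suc w))) ≤∘ ≡≤ (sym (NP.*-distribʳ-+ (b * suc w) 14 3))))

    weakPiece : ∀ (U V : Clause n) {w} → U ⊆c V → width V ≤ w → Pc (cP *P (D U -P D V)) (Mstep w) (suc w)
    weakPiece U V {w} h wV = pConv (λ u → refl) szb (mono U V (⊆c⇒⊑ U V h) (wV ≤∘ NP.n≤1+n _))
      where
      szb : 7 * B (suc w) * width V ≤ Mstep w
      szb = *≤ (≤r {7 * B (suc w)}) (wV ≤∘ NP.n≤1+n _) ≤∘ ≡≤ (NP.*-assoc 7 (B (suc w)) (suc w)) ≤∘ *≤ {7} {17} (NP.+-monoʳ-≤ 7 ℕ.z≤n) (≤r {B (suc w) * suc w})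

    axPiece' : ∀ (C : Clause n) {w} → width C ≤ w → C ∈ F → Pc (cP *P (0P -P D C)) (Mstep w) (suc w)
    axPiece' (P , N) {w} wC h = pConv (λ u → refl) szb (axPiece P N wC h)
      where
      b = B (suc w)
      szb : B w * suc (2 * w) + 6 * B (suc w) * w ≤ Mstep w
      szb = +≤ (*≤ (B-mono (NP.n≤1+n w)) (ℕ.s≤s (*≤ (≤r {2}) (NP.n≤1+n w)))) (*≤ (≤r {6 * b}) (NP.n≤1+n w))
          ≤∘ ≡≤ (NS.solve 2 (λ b v → b NS.:* (NS.con 1 NS.:+ NS.con 2 NS.:* v) NS.:+ NS.con 6 NS.:* b NS.:* v NS.:= NS.con 8 NS.:* (b NS.:* v) NS.:+ b) refl b (suc w))
          ≤∘ +≤ (≤r {8 * (b * suc w)}) (NP.m≤m*n b (suc w)) ≤∘ ≡≤ (NP.+-comm (8 * (b * suc w)) (b * suc w)) ≤∘ *≤ {9} {17} (NP.+-monoʳ-≤ 9 ℕ.z≤n) (≤r {b * suc w})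

module Telescope {n m : ℕ} {F : CNF n} {Ax : List (Poly m)} (Sy : Pieces.Sys n m F Ax)
                 {w L : ℕ} (ρ : ResRefutation F w L) where

  open Polynomials
  open Measures
  open Pieces
  open import Data.Nat as ℕ using (zero; suc; _≤_; _<_; _+_; _*_)
  import Data.Nat.Properties as NP
  open import Data.Fin using (Fin; toℕ; fromℕ<)
  import Data.Fin.Properties as FP
  open import Data.List using ([]; _∷_; _++_; foldr; filter)
  open import Data.List.Relation.Unary.All using (All; []; _∷_)
  open import Data.Product using (Σ; _×_; _,_; proj₁; proj₂)
  open import Data.Rational as Q using (ℚ; 0ℚ; 1ℚ)
  import Data.Rational.Properties as QP
  open import Data.Sum using (inj₁; inj₂)
  open import Relation.Binary.PropositionalEquality using (_≡_; refl; sym; trans; cong; subst)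
  open import Relation.Nullary using (Dec; yes; no; ¬_; ¬?)
  open import Data.Empty using (⊥-elim)
  open Sys Sy
  open ResRefutation ρ
  open PS m using (solve; _:+_; _:*_; _:-_; :-_; con; _:=_)
  open import Relation.Binary.Reasoning.Setoid (E-setoid {m})

  -- The common size budget per step (Mstep does not depend on the weight).
  M : ℕ
  M = Build.Mstep Sy 0ℚ (QP.≤-refl) w

  Dk : Fin L → Poly m
  Dk k = D (clauses k)

  ΣΠ : List (Fin L × ℚ) → Poly m
  ΣΠ = foldr (λ e acc → (constP (proj₂ e) *P Dk (proj₁ e)) +P acc) 0P

  -- The state after processing the clauses with index ≥ t: a derivation d and
  -- nonnegative weights on clauses with index < t with total d - Σ = -1, and size
  -- of d at most (L - t) · M.
  record State (t : ℕ) : Set where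
    field
      Π : List (Fin L × ℚ)
      d : Derivation Ax
      idx : All (λ e → toℕ (proj₁ e) < t) Π
      nn : All (λ e → 0ℚ Q.≤ proj₂ e) Π
      inv : (total d -P ΣΠ Π) ≈P constP (Q.- 1ℚ)
      szI : size d + t * M ≤ L * M
      rkI : rank d ≤ suc w
      t≤L : t ≤ L
  open State

  z0 : ⟨ 0P ⟩ ≈E ⟨ constP {m} 0ℚ ⟩
  z0 = mkE (λ u → sym (const-0 {m} u))

  module Split (k : Fin L) where
    IP? : (e : Fin L × ℚ) → Dec (proj₁ e ≡ k)
    IP? e = proj₁ e FP.≟ k
    nIP? : (e : Fin L × ℚ) → Dec (¬ (proj₁ e ≡ k))
    nIP? e = ¬? (IP? e)

    coef : List (Fin L × ℚ) → ℚ
    coef Π = foldr (λ e acc → proj₂ e Q.+ acc) 0ℚ (filter IP? Π)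

    split : ∀ Π → ⟨ ΣΠ Π ⟩ ≈E (⟨ constP (coef Π) ⟩ ⊗ ⟨ Dk k ⟩) ⊕ ⟨ ΣΠ (filter nIP? Π) ⟩
    split [] = transE z0 (transE (mkE (solve 1 (λ d → con 0ℚ := con 0ℚ :* d :+ con 0ℚ) (λ u → refl) (Dk k))) (⊕E reflE (symE z0)))
    split ((k' , a) ∷ Π) with k' FP.≟ k
    ... | yes refl = begin
          ⟨ ΣΠ ((k , a) ∷ Π) ⟩
        ≈⟨ mkE (λ u → refl) ⟩
          (⟨ constP a ⟩ ⊗ ⟨ Dk k ⟩) ⊕ ⟨ ΣΠ Π ⟩
        ≈⟨ ⊕E reflE (split Π) ⟩
          (⟨ constP a ⟩ ⊗ ⟨ Dk k ⟩) ⊕ ((⟨ constP (coef Π) ⟩ ⊗ ⟨ Dk k ⟩) ⊕ ⟨ ΣΠ (filter nIP? Π) ⟩)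
        ≈⟨ mkE (solve 4 (λ a c d r → a :* d :+ (c :* d :+ r) := (a :+ c) :* d :+ r) (λ u → refl) (constP a) (constP (coef Π)) (Dk k) (ΣΠ (filter nIP? Π))) ⟩
          ((⟨ constP a ⟩ ⊕ ⟨ constP (coef Π) ⟩) ⊗ ⟨ Dk k ⟩) ⊕ ⟨ ΣΠ (filter nIP? Π) ⟩
        ≈⟨ ⊕E (⊗E (symE (mkE (const-+ a (coef Π)))) reflE) reflE ⟩
          (⟨ constP (a Q.+ coef Π) ⟩ ⊗ ⟨ Dk k ⟩) ⊕ ⟨ ΣΠ (filter nIP? Π) ⟩ ∎
    ... | no ne = begin
          ⟨ ΣΠ ((k' , a) ∷ Π) ⟩
        ≈⟨ mkE (λ u → refl) ⟩
          (⟨ constP a ⟩ ⊗ ⟨ Dk k' ⟩) ⊕ ⟨ ΣΠ Π ⟩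
        ≈⟨ ⊕E reflE (split Π) ⟩
          (⟨ constP a ⟩ ⊗ ⟨ Dk k' ⟩) ⊕ ((⟨ constP (coef Π) ⟩ ⊗ ⟨ Dk k ⟩) ⊕ ⟨ ΣΠ (filter nIP? Π) ⟩)
        ≈⟨ mkE (solve 5 (λ a e c d r → a :* e :+ (c :* d :+ r) := c :* d :+ (a :* e :+ r)) (λ u → refl) (constP a) (Dk k') (constP (coef Π)) (Dk k) (ΣΠ (filter nIP? Π))) ⟩
          (⟨ constP (coef Π) ⟩ ⊗ ⟨ Dk k ⟩) ⊕ ((⟨ constP a ⟩ ⊗ ⟨ Dk k' ⟩) ⊕ ⟨ ΣΠ (filter nIP? Π) ⟩)
        ≈⟨ mkE (λ u → refl) ⟩
          (⟨ constP (coef Π) ⟩ ⊗ ⟨ Dk k ⟩) ⊕ ⟨ ΣΠ ((k' , a) ∷ filter nIP? Π) ⟩ ∎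

    coef-nn : ∀ Π → All (λ e → 0ℚ Q.≤ proj₂ e) Π → 0ℚ Q.≤ coef Π
    coef-nn [] [] = QP.≤-refl
    coef-nn ((k' , a) ∷ Π) (h ∷ hs) with k' FP.≟ k
    ... | yes _ = QP.+-mono-≤ h (coef-nn Π hs)
    ... | no _ = coef-nn Π hs

    nn₂ : ∀ Π → All (λ e → 0ℚ Q.≤ proj₂ e) Π → All (λ e → 0ℚ Q.≤ proj₂ e) (filter nIP? Π)
    nn₂ [] [] = []
    nn₂ ((k' , a) ∷ Π) (h ∷ hs) with k' FP.≟ k
    ... | yes _ = nn₂ Π hs
    ... | no _ = h ∷ nn₂ Π hs

    idx₂ : ∀ t Π → toℕ k ≡ t → All (λ e → toℕ (proj₁ e) < suc t) Π → All (λ e → toℕ (proj₁ e) < t) (filter nIP? Π)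
    idx₂ t [] tk [] = []
    idx₂ t ((k' , a) ∷ Π) tk (h ∷ hs) with k' FP.≟ k
    ... | yes _ = idx₂ t Π tk hs
    ... | no ne = lt ∷ idx₂ t Π tk hs
      where
      lt : toℕ k' < t
      lt with NP.m≤n⇒m<n∨m≡n (ℕ.s≤s⁻¹ h)
      ... | inj₁ p = p
      ... | inj₂ e = ⊥-elim (ne (FP.toℕ-injective (trans e (sym tk))))

  -- Processing clause k = t: its collected weight c is replaced by a piece that
  -- depends on how clause k was obtained, and c is passed on to its premises.
  module Process (t : ℕ) (S : State (suc t)) where
    k : Fin L
    k = fromℕ< (t≤L S)
    tk : toℕ k ≡ t
    tk = FP.toℕ-fromℕ< (t≤L S)
    open Split k
    c : ℚ
    c = coef (Π S)
    c0 : 0ℚ Q.≤ c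
    c0 = coef-nn (Π S) (nn S)
    open Build Sy c c0 using (axPiece'; resPiece; weakPiece; cP)
    Π₂ : List (Fin L × ℚ)
    Π₂ = filter nIP? (Π S)
    R : Poly m
    R = ΣΠ Π₂
    X : Poly m
    X = total (d S)
    spl : ⟨ ΣΠ (Π S) ⟩ ≈E (⟨ cP ⟩ ⊗ ⟨ Dk k ⟩) ⊕ ⟨ R ⟩
    spl = split (Π S)
    invS : ⟨ X ⟩ ⊝ ⟨ ΣΠ (Π S) ⟩ ≈E ⟨ constP (Q.- 1ℚ) ⟩
    invS = mkE (inv S)
    idx₂' : All (λ e → toℕ (proj₁ e) < t) Π₂
    idx₂' = idx₂ t (Π S) tk (idx S)
    nn₂' : All (λ e → 0ℚ Q.≤ proj₂ e) Π₂
    nn₂' = nn₂ (Π S) (nn S)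
    <t : ∀ {i : Fin L} → toℕ i < toℕ k → toℕ i < t
    <t h = subst (toℕ _ <_) tk h

    mkState : ∀ {Tp} (p : Piece {m} {Ax} Tp M (suc w)) Π' → All (λ e → toℕ (proj₁ e) < t) Π' → All (λ e → 0ℚ Q.≤ proj₂ e) Π' →
      (⟨ X ⟩ ⊕ ⟨ Tp ⟩) ⊝ ⟨ ΣΠ Π' ⟩ ≈E ⟨ X ⟩ ⊝ ⟨ ΣΠ (Π S) ⟩ → State t
    mkState {Tp} p Π' hi hn e = record
      { Π = Π'
      ; d = d S ++ der p
      ; idx = hi
      ; nn = hn
      ; inv = unE (transE {a = ⟨ total (d S ++ der p) ⟩ ⊝ ⟨ ΣΠ Π' ⟩} {b = (⟨ X ⟩ ⊕ ⟨ Tp ⟩) ⊝ ⟨ ΣΠ Π' ⟩}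
                 (⊝E (transE {b = ⟨ X ⟩ ⊕ ⟨ total (der p) ⟩} (mkE (total-++ (d S) (der p))) (⊕E reflE (mkE (tot p)))) reflE) (transE e invS))
      ; szI = NP.≤-trans (NP.≤-reflexive (cong (_+ t * M) (size-++ (d S) (der p))))
               (NP.≤-trans (NP.≤-reflexive (NP.+-assoc (size (d S)) _ _)) (NP.≤-trans (NP.+-monoʳ-≤ (size (d S)) (NP.+-monoˡ-≤ (t * M) (sz p))) (szI S)))
      ; rkI = rank-++ _ (d S) (der p) (rkI S) (rk p)
      ; t≤L = NP.≤-trans (NP.n≤1+n t) (t≤L S) }

    go : Step F clauses k → State t
    go (axiom h) = mkState (axPiece' (clauses k) (narrow k) h) Π₂ idx₂' nn₂' (transE (mkE (λ u → refl)) e)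
      where
      e : (⟨ X ⟩ ⊕ (⟨ cP ⟩ ⊗ (⟨ 0P ⟩ ⊝ ⟨ Dk k ⟩))) ⊝ ⟨ R ⟩ ≈E ⟨ X ⟩ ⊝ ⟨ ΣΠ (Π S) ⟩
      e = begin
          (⟨ X ⟩ ⊕ (⟨ cP ⟩ ⊗ (⟨ 0P ⟩ ⊝ ⟨ Dk k ⟩))) ⊝ ⟨ R ⟩
        ≈⟨ ⊝E (⊕E reflE (⊗E reflE (⊝E z0 reflE))) reflE ⟩
          (⟨ X ⟩ ⊕ (⟨ cP ⟩ ⊗ (⟨ constP 0ℚ ⟩ ⊝ ⟨ Dk k ⟩))) ⊝ ⟨ R ⟩
        ≈⟨ mkE (solve 4 (λ x c d r → (x :+ c :* (con 0ℚ :- d)) :- r := x :- (c :* d :+ r)) (λ u → refl) X cP (Dk k) R) ⟩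
          ⟨ X ⟩ ⊝ ((⟨ cP ⟩ ⊗ ⟨ Dk k ⟩) ⊕ ⟨ R ⟩)
        ≈⟨ ⊝E reflE (symE spl) ⟩
          ⟨ X ⟩ ⊝ ⟨ ΣΠ (Π S) ⟩ ∎
    go (resolve i j i<k j<k A B' x ei ej ek) =
      mkState (resPiece A B' x wi wj wk) ((i , c) ∷ (j , c) ∷ Π₂) (<t i<k ∷ <t j<k ∷ idx₂') (c0 ∷ c0 ∷ nn₂') (transE (mkE (λ u → refl)) e)
      where
      wi : width (A ∨ₗ x) ≤ w
      wi = subst (λ Z → width Z ≤ w) ei (narrow i)
      wj : width (B' ∨ₗ compl x) ≤ w
      wj = subst (λ Z → width Z ≤ w) ej (narrow j)
      wk : width (A ∨c B') ≤ w
      wk = subst (λ Z → width Z ≤ w) ek (narrow k)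
      e : (⟨ X ⟩ ⊕ (⟨ cP ⟩ ⊗ ((⟨ D (A ∨ₗ x) ⟩ ⊕ ⟨ D (B' ∨ₗ compl x) ⟩) ⊝ ⟨ D (A ∨c B') ⟩))) ⊝ ⟨ ΣΠ ((i , c) ∷ (j , c) ∷ Π₂) ⟩ ≈E ⟨ X ⟩ ⊝ ⟨ ΣΠ (Π S) ⟩
      e = begin
          (⟨ X ⟩ ⊕ (⟨ cP ⟩ ⊗ ((⟨ D (A ∨ₗ x) ⟩ ⊕ ⟨ D (B' ∨ₗ compl x) ⟩) ⊝ ⟨ D (A ∨c B') ⟩))) ⊝ ⟨ ΣΠ ((i , c) ∷ (j , c) ∷ Π₂) ⟩
        ≈⟨ ⊝E (⊕E reflE (⊗E reflE (⊝E (⊕E (≡E (cong D (sym ei))) (≡E (cong D (sym ej)))) (≡E (cong D (sym ek)))))) (mkE (λ u → refl)) ⟩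
          (⟨ X ⟩ ⊕ (⟨ cP ⟩ ⊗ ((⟨ Dk i ⟩ ⊕ ⟨ Dk j ⟩) ⊝ ⟨ Dk k ⟩))) ⊝ ((⟨ cP ⟩ ⊗ ⟨ Dk i ⟩) ⊕ ((⟨ cP ⟩ ⊗ ⟨ Dk j ⟩) ⊕ ⟨ R ⟩))
        ≈⟨ mkE (solve 6 (λ x c a b d r → (x :+ c :* ((a :+ b) :- d)) :- (c :* a :+ (c :* b :+ r)) := x :- (c :* d :+ r)) (λ u → refl) X cP (Dk i) (Dk j) (Dk k) R) ⟩
          ⟨ X ⟩ ⊝ ((⟨ cP ⟩ ⊗ ⟨ Dk k ⟩) ⊕ ⟨ R ⟩)
        ≈⟨ ⊝E reflE (symE spl) ⟩
          ⟨ X ⟩ ⊝ ⟨ ΣΠ (Π S) ⟩ ∎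
    go (weaken i i<k h) = mkState (weakPiece (clauses i) (clauses k) h (narrow k)) ((i , c) ∷ Π₂) (<t i<k ∷ idx₂') (c0 ∷ nn₂') (transE (mkE (λ u → refl)) e)
      where
      e : (⟨ X ⟩ ⊕ (⟨ cP ⟩ ⊗ (⟨ Dk i ⟩ ⊝ ⟨ Dk k ⟩))) ⊝ ⟨ ΣΠ ((i , c) ∷ Π₂) ⟩ ≈E ⟨ X ⟩ ⊝ ⟨ ΣΠ (Π S) ⟩
      e = begin
          (⟨ X ⟩ ⊕ (⟨ cP ⟩ ⊗ (⟨ Dk i ⟩ ⊝ ⟨ Dk k ⟩))) ⊝ ⟨ ΣΠ ((i , c) ∷ Π₂) ⟩
        ≈⟨ ⊝E reflE (mkE (λ u → refl)) ⟩
          (⟨ X ⟩ ⊕ (⟨ cP ⟩ ⊗ (⟨ Dk i ⟩ ⊝ ⟨ Dk k ⟩))) ⊝ ((⟨ cP ⟩ ⊗ ⟨ Dk i ⟩) ⊕ ⟨ R ⟩)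
        ≈⟨ mkE (solve 5 (λ x c a d r → (x :+ c :* (a :- d)) :- (c :* a :+ r) := x :- (c :* d :+ r)) (λ u → refl) X cP (Dk i) (Dk k) R) ⟩
          ⟨ X ⟩ ⊝ ((⟨ cP ⟩ ⊗ ⟨ Dk k ⟩) ⊕ ⟨ R ⟩)
        ≈⟨ ⊝E reflE (symE spl) ⟩
          ⟨ X ⟩ ⊝ ⟨ ΣΠ (Π S) ⟩ ∎

  stepS : ∀ t → State (suc t) → State t
  stepS t S = Process.go t S (steps (Process.k t S))

  run : ∀ t → State t → State 0
  run zero S = S
  run (suc t) S = run t (stepS t S)

  initial : State L
  initial = record
    { Π = (k₀ , 1ℚ) ∷ []
    ; d = []
    ; idx = subst (toℕ k₀ <_) e₀ (NP.n<1+n (toℕ k₀)) ∷ []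
    ; nn = QP.nonNegative⁻¹ 1ℚ ∷ []
    ; inv = unE eq
    ; szI = NP.≤-refl
    ; rkI = ℕ.z≤n
    ; t≤L = NP.≤-refl }
    where
    k₀ = proj₁ endsEmpty
    e₀ = proj₁ (proj₂ endsEmpty)
    eq : ⟨ [] ⟩ ⊝ ((⟨ constP 1ℚ ⟩ ⊗ ⟨ Dk k₀ ⟩) ⊕ ⟨ 0P ⟩) ≈E ⟨ constP (Q.- 1ℚ) ⟩
    eq = begin
        ⟨ [] ⟩ ⊝ ((⟨ constP 1ℚ ⟩ ⊗ ⟨ Dk k₀ ⟩) ⊕ ⟨ 0P ⟩)
      ≈⟨ ⊝E z0 (⊕E (⊗E reflE (transE (≡E (cong D (proj₂ (proj₂ endsEmpty)))) (mkE D-∅))) z0) ⟩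
        ⟨ constP 0ℚ ⟩ ⊝ ((⟨ constP 1ℚ ⟩ ⊗ ⟨ constP 1ℚ ⟩) ⊕ ⟨ constP 0ℚ ⟩)
      ≈⟨ mkE (solve 0 (con 0ℚ :- (con 1ℚ :* con 1ℚ :+ con 0ℚ) := con (Q.- 1ℚ)) (λ u → refl)) ⟩
        ⟨ constP (Q.- 1ℚ) ⟩ ∎

  -- After processing all clauses nothing is pending, so d is a refutation.
  result : Σ (Derivation Ax) λ d → Refutes d × (rank d ≤ suc w) × (size d ≤ L * M)
  result = d S₀ , ref , rkI S₀ , NP.≤-trans (NP.m≤m+n (size (d S₀)) 0) (szI S₀)
    where
    S₀ = run L initial
    Πnil : Π S₀ ≡ []
    Πnil with Π S₀ | idx S₀
    ... | [] | _ = refl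
    ... | e ∷ _ | () ∷ _
    ref : Refutes (d S₀)
    ref u = trans (sym (+P-identityʳ (total (d S₀)) u)) (trans (cong (λ Z → coeff (total (d S₀) -P ΣΠ Z) u) (sym Πnil)) (inv S₀ u))

module Encodings where

  open Polynomials
  open Measures
  open SubsetProducts
  open ClauseAlgebra
  open Pieces
  open import Data.Nat as ℕ using (ℕ; zero; suc; _≤_; _+_; _*_; _^_)
  import Data.Nat.Properties as NP
  open import Data.Nat.Solver using (module +-*-Solver)
  open +-*-Solver using () renaming (solve to solveℕ; _:+_ to _⊹_; _:*_ to _⊛_; con to κ; _:=_ to _≐_)
  open import Data.Fin using (Fin; zero; suc)
  open import Data.Fin.Subset using (Subset; ∣_∣; ⁅_⁆; _∪_) renaming (⊥ to ∅)
  open import Data.Vec as V using (replicate)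
  open import Data.List using ([]; _∷_; length; map)
  open import Data.List.Relation.Unary.All using ([]; _∷_)
  open import Data.List.Relation.Unary.Any as Any using (here; there)
  open import Data.List.Membership.Propositional using (_∈_)
  import Data.List.Membership.Propositional.Properties as MP
  open import Data.Product using (_×_; _,_; proj₁; proj₂)
  open import Data.Bool using (true; false)
  open import Data.Rational as Q using (ℚ; 0ℚ; 1ℚ)
  open import Relation.Binary.PropositionalEquality using (_≡_; refl; sym; trans; cong; cong₂; subst; module ≡-Reasoning)

  FR-false : ∀ {X : Set} {k} (h : Fin k → X → X) e → FR h (replicate k false) e ≡ e
  FR-false {k = zero} h e = refl
  FR-false {k = suc k} h e = FR-false (λ i → h (suc i)) e

  ΣF-length : ∀ {m k} (f : Fin k → Poly m) (S : Subset k) e a → (∀ i → length (f i) ≡ a) →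
    length (FR (λ i acc → f i +P acc) S e) ≡ a * ∣ S ∣ + length e
  ΣF-length f V.[] e a h = cong (_+ length e) (sym (NP.*-zeroʳ a))
  ΣF-length f (true V.∷ S) e a h = trans (length-+P (f zero) _) (trans (cong₂ _+_ (h zero) (ΣF-length (λ i → f (suc i)) S e a (λ i → h (suc i))))
    (trans (sym (NP.+-assoc a (a * ∣ S ∣) _)) (cong (_+ length e) (sym (NP.*-suc a ∣ S ∣)))))
  ΣF-length f (false V.∷ S) e a h = ΣF-length (λ i → f (suc i)) S e a (λ i → h (suc i))

  ΣF-deg : ∀ {m k} (f : Fin k → Poly m) (S : Subset k) e r → (∀ i → DegLe (f i) r) → DegLe e r → DegLe (FR (λ i acc → f i +P acc) S e) r
  ΣF-deg f V.[] e r h he = he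
  ΣF-deg f (true V.∷ S) e r h he = DegLe-++ (h zero) (ΣF-deg (λ i → f (suc i)) S e r (λ i → h (suc i)) he)
  ΣF-deg f (false V.∷ S) e r h he = ΣF-deg (λ i → f (suc i)) S e r (λ i → h (suc i)) he

  boolAx : ∀ {m} → Fin m → Poly m
  boolAx i = (varP i *P varP i) -P varP i

  boolAx∈ : ∀ {m} (i : Fin m) → boolAx i ∈ boolAxioms {m}
  boolAx∈ {m} i = MP.∈-concatMap⁺ (λ i → ((varP i *P varP i) -P varP i) ∷ (varP i -P (varP i *P varP i)) ∷ []) (Any.map (λ { refl → here refl }) (MP.∈-allFin i))

  boolAx-deg : ∀ {m} (i : Fin m) → DegLe (boolAx i) 2
  boolAx-deg i = DegLe-++ (DegLe-* (DegLe-var i) (DegLe-var i)) (DegLe-mono (ℕ.s≤s ℕ.z≤n) (DegLe-neg (DegLe-var i)))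

  om : ∀ {m} → Fin m → Poly m
  om j = constP 1ℚ -P varP j

  om-deg : ∀ {m} (j : Fin m) → DegLe (om j) 1
  om-deg j = DegLe-++ (DegLe-mono ℕ.z≤n (DegLe-const 1ℚ)) (DegLe-neg (DegLe-var j))

  prodOver-∅ : ∀ {m} (f : Fin m → Poly m) → prodOver f ∅ ≡ constP 1ℚ
  prodOver-∅ {m} f = trans (prodOver-FR f ∅) (FR-false {k = m} (λ i acc → f i *P acc) (constP 1ℚ))

  -- SA: φ(x_i) = 1 - x_i, φ(x̄_i) = x_i, so D (P, N) = ∏_{j∈N} x_j ∏_{i∈P} (1 - x_i)
  -- is exactly the product of an SA summand, with 2^|P| terms.  No complementarity axioms are
  -- needed since φ ℓ + φ (compl ℓ) = 1 holds identically.
  module SA {n : ℕ} (F : CNF n) where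
    open PS n using (solve; _:+_; _:*_; _:-_; :-_; con; _:=_)
    Ax : List (Poly n)
    Ax = axiomsSA F

    φ : Literal n → Poly n
    φ (pos i) = om i
    φ (neg i) = varP i

    D : Clause n → Poly n
    D (P , N) = prodOver varP N *P prodOver om P

    vr : Literal n → Fin n
    vr (pos i) = i
    vr (neg i) = i

    DF : ∀ P N → D (P , N) ≡ (ΠF varP N (constP 1ℚ) *P ΠF om P (constP 1ℚ))
    DF P N = cong₂ _*P_ (prodOver-FR varP N) (prodOver-FR om P)

    D-ins : ∀ C ℓ → mem ℓ C ≡ false → D (C ∨ₗ ℓ) ≈P (φ ℓ *P D C)
    D-ins (P , N) (pos i) h u = trans (cong (λ z → coeff z u) (DF (P ∪ ⁅ i ⁆) N)) (trans (unE eq u) (sym (cong (λ z → coeff (om i *P z) u) (DF P N))))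
      where
      a : Poly n
      a = ΠF varP N (constP 1ℚ)
      eq : ⟨ a ⟩ ⊗ ⟨ ΠF om (P ∪ ⁅ i ⁆) (constP 1ℚ) ⟩ ≈E ⟨ om i ⟩ ⊗ (⟨ a ⟩ ⊗ ⟨ ΠF om P (constP 1ℚ) ⟩)
      eq = transE {b = ⟨ a ⟩ ⊗ (⟨ om i ⟩ ⊗ ⟨ ΠF om P (constP 1ℚ) ⟩)} (⊗E reflE (mkE (ΠF-insert om P i (constP 1ℚ) h)))
             (mkE (solve 3 (λ a b c → a :* (b :* c) := b :* (a :* c)) (λ u → refl) a (om i) (ΠF om P (constP 1ℚ))))
    D-ins (P , N) (neg i) h u = trans (cong (λ z → coeff z u) (DF P (N ∪ ⁅ i ⁆))) (trans (unE eq u) (sym (cong (λ z → coeff (varP i *P z) u) (DF P N))))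
      where
      b : Poly n
      b = ΠF om P (constP 1ℚ)
      eq : ⟨ ΠF varP (N ∪ ⁅ i ⁆) (constP 1ℚ) ⟩ ⊗ ⟨ b ⟩ ≈E ⟨ varP i ⟩ ⊗ (⟨ ΠF varP N (constP 1ℚ) ⟩ ⊗ ⟨ b ⟩)
      eq = transE {b = (⟨ varP i ⟩ ⊗ ⟨ ΠF varP N (constP 1ℚ) ⟩) ⊗ ⟨ b ⟩} (⊗E (mkE (ΠF-insert varP N i (constP 1ℚ) h)) reflE)
             (mkE (solve 3 (λ a x c → (x :* a) :* c := x :* (a :* c)) (λ u → refl) (ΠF varP N (constP 1ℚ)) (varP i) b))

    D-∅ : D emptyClause ≈P constP 1ℚ
    D-∅ u = trans (cong₂ (λ a b → coeff (a *P b) u) (prodOver-∅ varP) (prodOver-∅ om)) (*P-identityˡ (constP 1ℚ) u)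

    one∈ : constP 1ℚ ∈ Ax
    one∈ = MP.∈-++⁺ʳ (map encSA F) (MP.∈-++⁺ʳ boolAxioms (here refl))

    bφ : Literal n → Poly n
    bφ ℓ = boolAx (vr ℓ)

    bφ-eq : ∀ ℓ → bφ ℓ ≈P ((φ ℓ *P φ ℓ) -P φ ℓ)
    bφ-eq (pos i) = solve 1 (λ x → (x :* x) :- x := ((con 1ℚ :- x) :* (con 1ℚ :- x)) :- (con 1ℚ :- x)) (λ u → refl) (varP i)
    bφ-eq (neg i) u = refl

    cax-eq : ∀ ℓ → ΣP {n} [] ≈P ((constP 1ℚ -P φ ℓ) -P φ (compl ℓ))
    cax-eq (pos i) u = trans (sym (const-0 {n} u)) (solve 1 (λ x → con 0ℚ := (con 1ℚ :- (con 1ℚ :- x)) :- x) (λ u → refl) (varP i) u)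
    cax-eq (neg i) u = trans (sym (const-0 {n} u)) (solve 1 (λ x → con 0ℚ := (con 1ℚ :- x) :- (con 1ℚ :- x)) (λ u → refl) (varP i) u)

    ncax-eq : ∀ ℓ → ΣP {n} [] ≈P ((φ ℓ +P φ (compl ℓ)) -P constP 1ℚ)
    ncax-eq (pos i) u = trans (sym (const-0 {n} u)) (solve 1 (λ x → con 0ℚ := ((con 1ℚ :- x) :+ x) :- con 1ℚ) (λ u → refl) (varP i) u)
    ncax-eq (neg i) u = trans (sym (const-0 {n} u)) (solve 1 (λ x → con 0ℚ := (x :+ (con 1ℚ :- x)) :- con 1ℚ) (λ u → refl) (varP i) u)

    arith : ∀ p q → (1 * p + 0 + (2 * q + 0)) + 1 ≤ suc (2 * (p + q))
    arith p q = NP.≤-trans (NP.≤-reflexive e1) (ℕ.s≤s (NP.≤-trans (NP.m≤m+n (p + 2 * q) p) (NP.≤-reflexive e2)))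
      where
      e1 : (1 * p + 0 + (2 * q + 0)) + 1 ≡ suc (p + 2 * q)
      e1 = solveℕ 2 (λ p q → (κ 1 ⊛ p ⊹ κ 0 ⊹ (κ 2 ⊛ q ⊹ κ 0)) ⊹ κ 1 ≐ κ 1 ⊹ (p ⊹ κ 2 ⊛ q)) refl p q
      e2 : (p + 2 * q) + p ≡ 2 * (p + q)
      e2 = solveℕ 2 (λ p q → (p ⊹ κ 2 ⊛ q) ⊹ p ≐ κ 2 ⊛ (p ⊹ q)) refl p q

    enc-len : ∀ (C : Clause n) → length (encSA C) ≤ suc (2 * width C)
    enc-len (P , N) = NP.≤-trans (NP.≤-reflexive e) (arith ∣ P ∣ ∣ N ∣)
      where
      e : length (encSA (P , N)) ≡ (1 * ∣ P ∣ + 0 + (2 * ∣ N ∣ + 0)) + 1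
      e = trans (length-+P (sumOver varP P +P sumOver om N) (-P constP 1ℚ))
            (cong (_+ 1) (trans (length-+P (sumOver varP P) (sumOver om N))
              (cong₂ _+_ (trans (cong length (sumOver-FR varP P)) (ΣF-length varP P [] 1 (λ _ → refl)))
                         (trans (cong length (sumOver-FR om N)) (ΣF-length om N [] 2 (λ _ → refl))))))

    enc-deg : ∀ (C : Clause n) → DegLe (encSA C) 1
    enc-deg (P , N) = DegLe-++ (DegLe-++ (subst (λ z → DegLe z 1) (sym (sumOver-FR varP P)) (ΣF-deg varP P [] 1 DegLe-var []))
                                         (subst (λ z → DegLe z 1) (sym (sumOver-FR om N)) (ΣF-deg om N [] 1 om-deg [])))
                               (DegLe-neg (DegLe-mono ℕ.z≤n (DegLe-const 1ℚ)))

    mk : (α : ℚ) → 0ℚ Q.≤ α → Clause n → (p : Poly n) → p ∈ Ax → Summand Ax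
    mk α h (P , N) p h' = record { α = α ; α≥0 = h ; I = N ; J = P ; p = p ; p∈ = h' }

    mk-eq : ∀ α h (W : Clause n) (p : Poly n) h' → expand (mk α h W p h') ≈P (constP α *P (D W *P p))
    mk-eq α h (P , N) p h' = solve 4 (λ a x y q → a :* (x :* (y :* q)) := a :* ((x :* y) :* q)) (λ u → refl) (constP α) (prodOver varP N) (prodOver om P) p

    mk-len : ∀ α h (W : Clause n) (p : Poly n) h' → length (expand (mk α h W p h')) ≤ 2 ^ width W * length p
    mk-len α h (P , N) p h' = NP.≤-trans (NP.≤-reflexive e) (NP.*-monoˡ-≤ (length p) (NP.^-monoʳ-≤ 2 (NP.m≤m+n ∣ P ∣ ∣ N ∣)))
      where
      X = prodOver varP N
      Y = prodOver om P
      lenX : length X ≡ 1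
      lenX = trans (cong length (prodOver-FR varP N)) (ΠF-length1 varP N (constP 1ℚ) (λ _ → refl))
      lenY : length Y ≡ 2 ^ ∣ P ∣ * 1
      lenY = trans (cong length (prodOver-FR om P)) (ΠF-length2 om P (constP 1ℚ) (λ _ → refl))
      e : length (expand (mk α h (P , N) p h')) ≡ 2 ^ ∣ P ∣ * length p
      e = begin
          length (constP α *P (X *P (Y *P p)))
        ≡⟨ length-*P (constP α) (X *P (Y *P p)) ⟩
          1 * length (X *P (Y *P p))
        ≡⟨ NP.*-identityˡ _ ⟩
          length (X *P (Y *P p))
        ≡⟨ length-*P X (Y *P p) ⟩
          length X * length (Y *P p)
        ≡⟨ cong₂ _*_ lenX (length-*P Y p) ⟩
          1 * (length Y * length p)
        ≡⟨ NP.*-identityˡ _ ⟩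
          length Y * length p
        ≡⟨ cong (_* length p) (trans lenY (NP.*-identityʳ (2 ^ ∣ P ∣))) ⟩
          2 ^ ∣ P ∣ * length p ∎
        where open ≡-Reasoning

    mk-deg : ∀ α h (W : Clause n) (p : Poly n) h' r → DegLe p r → DegLe (expand (mk α h W p h')) (width W + r)
    mk-deg α h (P , N) p h' r dg = DegLe-mono (NP.≤-reflexive e) (DegLe-* (DegLe-const α) (DegLe-* dN (DegLe-* dP dg)))
      where
      dN : DegLe (prodOver varP N) (∣ N ∣ + 0)
      dN = subst (λ z → DegLe z (∣ N ∣ + 0)) (sym (prodOver-FR varP N)) (ΠF-deg varP N (constP 1ℚ) 0 DegLe-var (DegLe-const 1ℚ))
      dP : DegLe (prodOver om P) (∣ P ∣ + 0)
      dP = subst (λ z → DegLe z (∣ P ∣ + 0)) (sym (prodOver-FR om P)) (ΠF-deg om P (constP 1ℚ) 0 om-deg (DegLe-const 1ℚ))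
      e : 0 + ((∣ N ∣ + 0) + ((∣ P ∣ + 0) + r)) ≡ (∣ P ∣ + ∣ N ∣) + r
      e = solveℕ 3 (λ a b r → κ 0 ⊹ ((b ⊹ κ 0) ⊹ ((a ⊹ κ 0) ⊹ r)) ≐ (a ⊹ b) ⊹ r) refl ∣ P ∣ ∣ N ∣ r

    encoding : Sys n n F Ax
    encoding = record
      { φ = φ ; D = D ; D-∅ = D-∅ ; D-ins = D-ins ; one∈ = one∈
      ; bφ = bφ ; bφ∈ = λ ℓ → MP.∈-++⁺ʳ (map encSA F) (MP.∈-++⁺ˡ (boolAx∈ (vr ℓ))) ; bφ-eq = bφ-eq
      ; bφ-len = λ ℓ → ℕ.s≤s (ℕ.s≤s ℕ.z≤n) ; bφ-deg = λ ℓ → boolAx-deg (vr ℓ)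
      ; cax = λ _ → [] ; cax∈ = λ _ → [] ; cax-eq = cax-eq ; cax-len = λ _ → [] ; cax-deg = λ _ → [] ; cax-count = λ _ → ℕ.z≤n
      ; ncax = λ _ → [] ; ncax∈ = λ _ → [] ; ncax-eq = ncax-eq ; ncax-len = λ _ → [] ; ncax-deg = λ _ → [] ; ncax-count = λ _ → ℕ.z≤n
      ; enc = encSA ; enc∈ = λ C h → MP.∈-++⁺ˡ (MP.∈-map⁺ encSA h) ; enc-eq = λ P N u → refl ; enc-len = enc-len ; enc-deg = enc-deg
      ; B = 2 ^_ ; B-mono = NP.^-monoʳ-≤ 2
      ; mk = mk ; mk-eq = mk-eq ; mk-len = mk-len ; mk-deg = mk-deg }

  -- SAR: φ(x_i) = x̄_i, φ(x̄_i) = x_i, so D (P, N) = ∏_{j∈N} x_j ∏_{i∈P} x̄_i is a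
  -- monomial; the complementarity axioms relate φ ℓ and φ (compl ℓ).
  module SAR {n : ℕ} (F : CNF n) where
    open PS (n + n) using (solve; _:+_; _:*_; _:-_; :-_; con; _:=_)
    Ax : List (Poly (n + n))
    Ax = axiomsSAR F
    m : ℕ
    m = n + n

    fN : Fin n → Poly m
    fN i = varP (xV i)
    fP : Fin n → Poly m
    fP i = varP (x̄V i)

    φ : Literal n → Poly m
    φ (pos i) = fP i
    φ (neg i) = fN i

    vr : Literal n → Fin m
    vr (pos i) = x̄V i
    vr (neg i) = xV i

    idx : Literal n → Fin n
    idx (pos i) = i
    idx (neg i) = i

    D : Clause n → Poly m
    D (P , N) = prodOver varP (N V.++ P)

    DF : ∀ P N → D (P , N) ≡ ΠF fN N (ΠF fP P (constP 1ℚ))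
    DF P N = trans (prodOver-FR varP (N V.++ P)) (ΠF-++ varP N P (constP 1ℚ))

    D-ins : ∀ C ℓ → mem ℓ C ≡ false → D (C ∨ₗ ℓ) ≈P (φ ℓ *P D C)
    D-ins (P , N) (pos i) h u = trans (cong (λ z → coeff z u) (DF (P ∪ ⁅ i ⁆) N))
      (trans (ΠF-cong fN N (ΠF-insert fP P i (constP 1ℚ) h) u)
      (trans (ΠF-base fN N (fP i) (ΠF fP P (constP 1ℚ)) u) (sym (cong (λ z → coeff (fP i *P z) u) (DF P N)))))
    D-ins (P , N) (neg i) h u = trans (cong (λ z → coeff z u) (DF P (N ∪ ⁅ i ⁆)))
      (trans (ΠF-insert fN N i (ΠF fP P (constP 1ℚ)) h u) (sym (cong (λ z → coeff (fN i *P z) u) (DF P N))))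

    D-∅ : D emptyClause ≈P constP 1ℚ
    D-∅ u = cong (λ z → coeff z u) (trans (DF ∅ ∅) (trans (FR-false {k = n} (λ i acc → fN i *P acc) _) (FR-false {k = n} (λ i acc → fP i *P acc) (constP 1ℚ))))

    one∈ : constP 1ℚ ∈ Ax
    one∈ = MP.∈-++⁺ʳ (map encSAR F) (MP.∈-++⁺ʳ (boolAxioms {m}) (MP.∈-++⁺ʳ (complAxioms {n}) (here refl)))

    ca na : Fin n → Poly m
    ca i = (constP 1ℚ -P varP (xV i)) -P varP (x̄V i)
    na i = (constP (Q.- 1ℚ) +P varP (xV i)) +P varP (x̄V i)

    ca∈ : ∀ i → ca i ∈ Ax
    ca∈ i = MP.∈-++⁺ʳ (map encSAR F) (MP.∈-++⁺ʳ boolAxioms (MP.∈-++⁺ˡ (MP.∈-concatMap⁺ (λ i → ca i ∷ na i ∷ []) (Any.map (λ { refl → here refl }) (MP.∈-allFin i)))))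
    na∈ : ∀ i → na i ∈ Ax
    na∈ i = MP.∈-++⁺ʳ (map encSAR F) (MP.∈-++⁺ʳ boolAxioms (MP.∈-++⁺ˡ (MP.∈-concatMap⁺ (λ i → ca i ∷ na i ∷ []) (Any.map (λ { refl → there (here refl) }) (MP.∈-allFin i)))))

    cax-eq : ∀ ℓ → ΣP (ca (idx ℓ) ∷ []) ≈P ((constP 1ℚ -P φ ℓ) -P φ (compl ℓ))
    cax-eq (pos i) u = trans (+P-identityʳ (ca i) u) (solve 2 (λ x y → (con 1ℚ :- x) :- y := (con 1ℚ :- y) :- x) (λ u → refl) (varP (xV i)) (varP (x̄V i)) u)
    cax-eq (neg i) u = +P-identityʳ (ca i) u

    ncax-eq : ∀ ℓ → ΣP (na (idx ℓ) ∷ []) ≈P ((φ ℓ +P φ (compl ℓ)) -P constP 1ℚ)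
    ncax-eq (pos i) u = trans (+P-identityʳ (na i) u) (solve 2 (λ x y → (con (Q.- 1ℚ) :+ x) :+ y := (y :+ x) :- con 1ℚ) (λ u → refl) (varP (xV i)) (varP (x̄V i)) u)
    ncax-eq (neg i) u = trans (+P-identityʳ (na i) u) (solve 2 (λ x y → (con (Q.- 1ℚ) :+ x) :+ y := (x :+ y) :- con 1ℚ) (λ u → refl) (varP (xV i)) (varP (x̄V i)) u)

    ca-deg : ∀ i → DegLe (ca i) 1
    ca-deg i = DegLe-++ (DegLe-++ (DegLe-mono ℕ.z≤n (DegLe-const 1ℚ)) (DegLe-neg (DegLe-var (xV i)))) (DegLe-neg (DegLe-var (x̄V i)))
    na-deg : ∀ i → DegLe (na i) 1
    na-deg i = DegLe-++ (DegLe-++ (DegLe-mono ℕ.z≤n (DegLe-const (Q.- 1ℚ))) (DegLe-var (xV i))) (DegLe-var (x̄V i))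

    len3 : ∀ i → length (ca i) ≤ 3 × length (na i) ≤ 3
    len3 i = (ℕ.s≤s (ℕ.s≤s (ℕ.s≤s ℕ.z≤n))) , (ℕ.s≤s (ℕ.s≤s (ℕ.s≤s ℕ.z≤n)))

    sumPos-FR : ∀ P → sumPos {n} P ≡ FR (λ i acc → fN i +P acc) P []
    sumPos-FR P = FR-allFin (λ i acc → fN i +P acc) P []
    sumNeg-FR : ∀ N → sumNeg {n} N ≡ FR (λ i acc → fP i +P acc) N []
    sumNeg-FR N = FR-allFin (λ i acc → fP i +P acc) N []

    enc-len : ∀ (C : Clause n) → length (encSAR C) ≤ suc (2 * width C)
    enc-len (P , N) = NP.≤-trans (NP.≤-reflexive e) (NP.≤-trans (NP.≤-reflexive e1) (ℕ.s≤s (NP.m≤m+n (∣ P ∣ + ∣ N ∣) _)))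
      where
      e : length (encSAR (P , N)) ≡ (1 * ∣ P ∣ + 0 + (1 * ∣ N ∣ + 0)) + 1
      e = trans (length-+P (sumPos P +P sumNeg N) (-P constP 1ℚ))
            (cong (_+ 1) (trans (length-+P (sumPos P) (sumNeg N))
              (cong₂ _+_ (trans (cong length (sumPos-FR P)) (ΣF-length fN P [] 1 (λ _ → refl)))
                         (trans (cong length (sumNeg-FR N)) (ΣF-length fP N [] 1 (λ _ → refl))))))
      e1 : (1 * ∣ P ∣ + 0 + (1 * ∣ N ∣ + 0)) + 1 ≡ suc (∣ P ∣ + ∣ N ∣)
      e1 = solveℕ 2 (λ p q → (κ 1 ⊛ p ⊹ κ 0 ⊹ (κ 1 ⊛ q ⊹ κ 0)) ⊹ κ 1 ≐ κ 1 ⊹ (p ⊹ q)) refl ∣ P ∣ ∣ N ∣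

    enc-deg : ∀ (C : Clause n) → DegLe (encSAR C) 1
    enc-deg (P , N) = DegLe-++ (DegLe-++ (subst (λ z → DegLe z 1) (sym (sumPos-FR P)) (ΣF-deg fN P [] 1 (λ i → DegLe-var (xV i)) []))
                                         (subst (λ z → DegLe z 1) (sym (sumNeg-FR N)) (ΣF-deg fP N [] 1 (λ i → DegLe-var (x̄V i)) [])))
                               (DegLe-neg (DegLe-mono ℕ.z≤n (DegLe-const 1ℚ)))

    mk : (α : ℚ) → 0ℚ Q.≤ α → Clause n → (p : Poly m) → p ∈ Ax → Summand Ax
    mk α h (P , N) p h' = record { α = α ; α≥0 = h ; I = N V.++ P ; J = ∅ ; p = p ; p∈ = h' }

    om∅ : prodOver {m} (λ j → constP 1ℚ -P varP j) ∅ ≡ constP 1ℚ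
    om∅ = prodOver-∅ om

    mk-eq : ∀ α h (W : Clause n) (p : Poly m) h' → expand (mk α h W p h') ≈P (constP α *P (D W *P p))
    mk-eq α h (P , N) p h' u = trans (cong (λ z → coeff (constP α *P (D (P , N) *P (z *P p))) u) om∅)
      (solve 3 (λ a x q → a :* (x :* (con 1ℚ :* q)) := a :* (x :* q)) (λ u → refl) (constP α) (D (P , N)) p u)

    mk-len : ∀ α h (W : Clause n) (p : Poly m) h' → length (expand (mk α h W p h')) ≤ 1 * length p
    mk-len α h (P , N) p h' = NP.≤-reflexive e
      where
      X = prodOver varP (N V.++ P)
      lenX : length X ≡ 1
      lenX = trans (cong length (prodOver-FR varP (N V.++ P))) (ΠF-length1 varP (N V.++ P) (constP 1ℚ) (λ _ → refl))
      e : length (expand (mk α h (P , N) p h')) ≡ 1 * length p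
      e = begin
          length (constP α *P (X *P (prodOver om ∅ *P p)))
        ≡⟨ length-*P (constP α) (X *P (prodOver om ∅ *P p)) ⟩
          1 * length (X *P (prodOver om ∅ *P p))
        ≡⟨ NP.*-identityˡ _ ⟩
          length (X *P (prodOver om ∅ *P p))
        ≡⟨ length-*P X (prodOver om ∅ *P p) ⟩
          length X * length (prodOver om ∅ *P p)
        ≡⟨ cong₂ _*_ lenX (trans (length-*P (prodOver om ∅) p) (cong (λ z → length z * length p) om∅)) ⟩
          1 * (1 * length p)
        ≡⟨ NP.*-identityˡ _ ⟩
          1 * length p ∎
        where open ≡-Reasoning

    mk-deg : ∀ α h (W : Clause n) (p : Poly m) h' r → DegLe p r → DegLe (expand (mk α h W p h')) (width W + r)
    mk-deg α h (P , N) p h' r dg = DegLe-mono (NP.≤-reflexive e) (DegLe-* (DegLe-const α) (DegLe-* dX (DegLe-* d∅ dg)))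
      where
      dX : DegLe (prodOver varP (N V.++ P)) (∣ N ∣ + (∣ P ∣ + 0))
      dX = subst (λ z → DegLe z (∣ N ∣ + (∣ P ∣ + 0))) (sym (DF P N))
             (ΠF-deg fN N _ (∣ P ∣ + 0) (λ i → DegLe-var (xV i)) (ΠF-deg fP P (constP 1ℚ) 0 (λ i → DegLe-var (x̄V i)) (DegLe-const 1ℚ)))
      d∅ : DegLe (prodOver om ∅) 0
      d∅ = subst (λ z → DegLe z 0) (sym om∅) (DegLe-const 1ℚ)
      e : 0 + ((∣ N ∣ + (∣ P ∣ + 0)) + (0 + r)) ≡ (∣ P ∣ + ∣ N ∣) + r
      e = solveℕ 3 (λ a b r → κ 0 ⊹ ((b ⊹ (a ⊹ κ 0)) ⊹ (κ 0 ⊹ r)) ≐ (a ⊹ b) ⊹ r) refl ∣ P ∣ ∣ N ∣ r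

    encoding : Sys n m F Ax
    encoding = record
      { φ = φ ; D = D ; D-∅ = D-∅ ; D-ins = D-ins ; one∈ = one∈
      ; bφ = λ ℓ → boolAx (vr ℓ) ; bφ∈ = λ ℓ → MP.∈-++⁺ʳ (map encSAR F) (MP.∈-++⁺ˡ (boolAx∈ (vr ℓ)))
      ; bφ-eq = λ { (pos i) u → refl ; (neg i) u → refl }
      ; bφ-len = λ ℓ → ℕ.s≤s (ℕ.s≤s ℕ.z≤n) ; bφ-deg = λ ℓ → boolAx-deg (vr ℓ)
      ; cax = λ ℓ → ca (idx ℓ) ∷ [] ; cax∈ = λ ℓ → ca∈ (idx ℓ) ∷ [] ; cax-eq = cax-eq
      ; cax-len = λ ℓ → proj₁ (len3 (idx ℓ)) ∷ [] ; cax-deg = λ ℓ → ca-deg (idx ℓ) ∷ [] ; cax-count = λ _ → NP.≤-refl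
      ; ncax = λ ℓ → na (idx ℓ) ∷ [] ; ncax∈ = λ ℓ → na∈ (idx ℓ) ∷ [] ; ncax-eq = ncax-eq
      ; ncax-len = λ ℓ → proj₂ (len3 (idx ℓ)) ∷ [] ; ncax-deg = λ ℓ → na-deg (idx ℓ) ∷ [] ; ncax-count = λ _ → NP.≤-refl
      ; enc = encSAR ; enc∈ = λ C h → MP.∈-++⁺ˡ (MP.∈-map⁺ encSAR h) ; enc-eq = λ P N u → refl ; enc-len = enc-len ; enc-deg = enc-deg
      ; B = λ _ → 1 ; B-mono = λ _ → NP.≤-refl
      ; mk = mk ; mk-eq = mk-eq ; mk-len = mk-len ; mk-deg = mk-deg }

open import Data.Nat using (_+_)
import Data.Nat.Properties as NP
open import Data.Nat.Solver using (module +-*-Solver)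
open +-*-Solver using (solve; _:*_; _:=_; con)
open import Data.Product using (_,_)
open import Relation.Binary.PropositionalEquality using (refl; sym; cong)

-- The per-step budget of the telescope is 17 · B(w+1) · (w+1); with B = 2^_ (SA)
-- and B = 1 (SAR), L such budgets fit under the bounds of the theorem for c = 68,
-- using  w + 1 ≤ 2 · max(w, 1).
suc≤2*⊔1 : ∀ w → suc w ≤ 2 * (w ⊔ 1)
suc≤2*⊔1 w = begin
  suc w             ≡⟨ NP.+-comm 1 w ⟩
  w + 1             ≤⟨ NP.+-mono-≤ (NP.m≤m⊔n w 1) (NP.m≤n⊔m w 1) ⟩
  (w ⊔ 1) + (w ⊔ 1) ≡⟨ cong ((w ⊔ 1) +_) (sym (NP.+-identityʳ (w ⊔ 1))) ⟩
  2 * (w ⊔ 1)       ∎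
  where open NP.≤-Reasoning

SA-budget : ∀ w L → L * (17 * (2 ^ suc w * suc w)) ≤ 68 * (w ⊔ 1) * 2 ^ w * L
SA-budget w L = begin
  L * (17 * (2 ^ suc w * suc w))           ≤⟨ NP.*-monoʳ-≤ L (NP.*-monoʳ-≤ 17 (NP.*-monoʳ-≤ (2 ^ suc w) (suc≤2*⊔1 w))) ⟩
  L * (17 * ((2 * 2 ^ w) * (2 * (w ⊔ 1)))) ≡⟨ solve 3 (λ l W e → l :* (con 17 :* ((con 2 :* e) :* (con 2 :* W))) := con 68 :* W :* e :* l) refl L (w ⊔ 1) (2 ^ w) ⟩
  68 * (w ⊔ 1) * 2 ^ w * L                 ∎
  where open NP.≤-Reasoning

SAR-budget : ∀ w L → L * (17 * (1 * suc w)) ≤ 68 * ((w ⊔ 1) ^ 2) * L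
SAR-budget w L = begin
  L * (17 * (1 * suc w))                  ≤⟨ NP.*-monoʳ-≤ L (NP.*-monoʳ-≤ 17 (NP.*-monoʳ-≤ 1 (suc≤2*⊔1 w))) ⟩
  L * (17 * (1 * (2 * (w ⊔ 1))))          ≡⟨ solve 2 (λ l W → l :* (con 17 :* (con 1 :* (con 2 :* W))) := con 34 :* (W :* con 1) :* l) refl L (w ⊔ 1) ⟩
  34 * ((w ⊔ 1) * 1) * L                  ≤⟨ NP.*-monoˡ-≤ L (NP.*-mono-≤ (NP.m≤m+n 34 34) (NP.*-monoʳ-≤ (w ⊔ 1) 1≤W)) ⟩
  68 * ((w ⊔ 1) * ((w ⊔ 1) * 1)) * L      ∎
  where
  open NP.≤-Reasoning
  1≤W : 1 ≤ (w ⊔ 1) * 1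
  1≤W = NP.≤-trans (NP.m≤n⊔m w 1) (NP.≤-reflexive (sym (NP.*-identityʳ (w ⊔ 1))))

lemma4p6 : Σ ℕ λ c → ∀ {n} (F : CNF n) (w L : ℕ) → ResRefutation F w L →
    (Σ (SARefutation F) λ d → Refutes d × (rank d ≤ suc w) × (size d ≤ c * (w ⊔ 1) * 2 ^ w * L))
    × (Σ (SARRefutation F) λ d → Refutes d × (rank d ≤ suc w) × (size d ≤ c * ((w ⊔ 1) ^ 2) * L))
lemma4p6 = 68 , λ F w L ρ → withBudget (SA-budget w L) (result (SA.encoding F) ρ)
                           , withBudget (SAR-budget w L) (result (SAR.encoding F) ρ)
  where
  open Telescope using (result)
  open Encodings using (module SA; module SAR)
  withBudget : ∀ {A : Set} {P Q : A → Set} {s : A → ℕ} {b b'} → b ≤ b' →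
    Σ A (λ d → P d × Q d × (s d ≤ b)) → Σ A (λ d → P d × Q d × (s d ≤ b'))
  withBudget b≤b' (d , p , q , s≤b) = d , p , q , NP.≤-trans s≤b b≤b'
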